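{- Let $n,d,k\in\omega\setminus\{0\}$ with $d\le n$. Then \[ H^R_{SR}(n,d,k)=H_{SR}(n,d,k)=\begin{cases}1, & \text{if } d=1,\\ d, & \text{if } k=1,\\ n, & \text{if } k>1 \text{ and } d>1,\end{cases} \] and \[ H^R_{ESR}(n,d,k)=H^R_{AD}(n,d,k)=H^R_{EAD}(n,d,k)=H_{AD}(n,d,k)=H_{AR}(n,d,k)=H_{ESR}(n,d,k)=H_{EAD}(n,d,k)=H_{EAR}(n,d,k)=n. \]
   Context: Let $\omega=\{0,1,2,\dots\}$ and let $\{a_i:i\in\omega\}$ be a set of attributes. A decision rule $r$ is an expression $(a_{i_1}=\delta_1)\wedge\cdots\wedge(a_{i_m}=\delta_m)\to\sigma$ with $m\in\omega$, pairwise different attributes $a_{i_1},\dots,a_{i_m}$, and $\delta_1,\dots,\delta_m,\sigma\in\omega$; $m$ is its length, $\sigma$ its right-hand side, $A(r)=\{a_{i_1},\dots,a_{i_m}\}$ and $K(r)=\{a_{i_1}=\delta_1,\dots,a_{i_m}=\delta_m\}$ (both empty if $m=0$). Two rules are equal iff they have the same $K(\cdot)$ and the same right-hand side. A decision rule system $S$ is a finite nonempty set of decision rules; $\Sigma$ is the set of all such systems. Let $A(S)=\bigcup_{r\in S}A(r)$, $n(S)=|A(S)|$, $D(Z)$ = set of right-hand sides of rules in $Z\subseteq S$, $d(S)$ = maximum length of a rule in $S$. For $a_i\in A(S)$, $V_S(a_i)=\{\delta:(a_i=\delta)\in\bigcup_{r\in S}K(r)\}$ and $EV_S(a_i)=V_S(a_i)\cup\{*\}$,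 where $*$ is a symbol not in $\omega$. $k(S)=\max\{|V_S(a_i)|:a_i\in A(S)\}$ if $n(S)>0$, and $k(S)=0$ if $n(S)=0$. A set of equations $\{a_{i_1}=\delta_1,\dots,a_{i_m}=\delta_m\}$ with $\delta_j\in\omega\cup\{*\}$ is inconsistent if there are $l\neq t$ with $i_l=i_t$ and $\delta_l\ne\delta_t$, and consistent otherwise. A decision tree over $S$ is a finite directed rooted tree in which each working (non-terminal) node is labeled with an attribute from $A(S)$ and each terminal node is labeled with a subset of $S$. In an o-tree, a working node labeled $a_i$ has exactly $|V_S(a_i)|$ outgoing edges, labeled with pairwise distinct elements of $V_S(a_i)$. In an e-tree, it has exactly $|EV_S(a_i)|$ outgoing edges, labeled with pairwise distinct elements of $EV_S(a_i)$. For a complete path $\xi$ (from the root to a terminal node), $K(\xi)$ is the set of equations $a_i=\delta$ such that $a_i$ labels a working node of $\xi$ and $\delta$ labels the edge of $\xi$ leaving that node. $\tau(\xi)$ is the set of rules labeling the terminal node of $\xi$, and $h(\xi)$ is the number of working nodes of $\xi$. The depth $h(\Gamma)$ is the maximum of $h(\xi)$ over all complete paths. An o-tree (resp. e-tree) $\Gamma$ over $S$ solves $AR(S)$ (resp. $EAR(S)$) if every complete path $\xi$ with $K(\xi)$ consistent satisfies: $K(r)\subseteq K(\xi)$ for all $r\in\tau(\xi)$, and $K(r)\cup K(\xi)$ is inconsistent for all $r\in S\setminus\tau(\xi)$. It solves $AD(S)$ (resp. $EAD(S)$) if every such $\xi$ satisfies: $K(r)\subseteq K(\xi)$ for all $r\in\tau(\xi)$,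 and $K(r)\cup K(\xi)$ is inconsistent for every $r\in S\setminus\tau(\xi)$ whose right-hand side does not belong to $D(\tau(\xi))$. It solves $SR(S)$ (resp. $ESR(S)$) if every such $\xi$ satisfies: $K(r)\subseteq K(\xi)$ for all $r\in\tau(\xi)$, and if $\tau(\xi)=\emptyset$ then $K(r)\cup K(\xi)$ is inconsistent for every $r\in S$. For $C\in\{AR,EAR,AD,EAD,SR,ESR\}$, $h_C(S)$ is the minimum depth of a decision tree over $S$ solving $C(S)$. If $n(S)=0$, this is $0$. $R_{SR}(S)$ is the set of $r\in S$ for which there is no $r'\in S$ with $K(r')\subsetneq K(r)$, and $S$ is SR-reduced if $R_{SR}(S)=S$. $R_{AD}(S)$ is the set of $r\in S$ for which there is no $r'\in S$ with the same right-hand side as $r$ and $K(r')\subsetneq K(r)$, and $S$ is AD-reduced if $R_{AD}(S)=S$. $\Sigma_{SR}$ and $\Sigma_{AD}$ denote the sets of SR-reduced and AD-reduced systems, respectively. For $C\in\{SR,ESR,AD,EAD,AR,EAR\}$ and $n,d,k\in\omega\setminus\{0\}$ with $d\le n$: $h_C(n,d,k)=\min\{h_C(S):S\in\Sigma,\ n(S)=n,\ d(S)=d,\ k(S)=k\}$ and $H_C(n,d,k)$ is the corresponding maximum. For $C\in\{SR,ESR,AD,EAD\}$, let $C'=SR$ if $C\in\{SR,ESR\}$ and $C'=AD$ if $C\in\{AD,EAD\}$. Then $h^R_C(n,d,k)$ and $H^R_C(n,d,k)$ are the same minimum and maximum taken over $S\in\Sigma_{C'}$. -}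

module Defs where

open import Data.Nat using (ℕ; zero; suc; _≤_; _<_; _⊔_)
open import Data.Nat.Properties using (_≟_)
open import Data.Product using (Σ; _×_; _,_; proj₁; proj₂; ∃-syntax)
open import Data.Sum using (_⊎_)
open import Data.Maybe using (Maybe; just; nothing)
open import Data.List using (List; []; _∷_; map; length; concatMap; filter; deduplicate; foldr; _++_)
open import Data.List.Relation.Unary.All using (All)
open import Data.List.Relation.Unary.Linked using (Linked)
open import Data.List.Membership.Propositional using (_∈_; _∉_)
open import Relation.Binary.PropositionalEquality using (_≡_; _≢_)
open import Relation.Nullary using (¬_)
open import Data.Unit using (⊤)

-- Attribute a_i is represented by its index i : ℕ.
-- A rule is a pair (K , σ) where K is the list of equations (i , δ)
-- meaning a_i = δ, and σ is the right-hand side.  A rule is valid when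
-- the attributes of K are strictly increasing; this is a canonical
-- (sorted) representation of the set K(r) with pairwise different
-- attributes, so two valid rules are equal (as in the paper: same K(.)
-- and same right-hand side) iff they are equal as Agda values.

Eqn : Set
Eqn = ℕ × ℕ

Rule : Set
Rule = List Eqn × ℕ

K : Rule → List Eqn
K = proj₁

rhs : Rule → ℕ
rhs = proj₂

ValidRule : Rule → Set
ValidRule r = Linked _<_ (map proj₁ (K r))

len : Rule → ℕ
len r = length (K r)

-- A decision rule system: a finite nonempty set of valid rules
-- (represented by a list; repetitions are irrelevant).
IsSystem : List Rule → Set
IsSystem S = (S ≢ []) × All ValidRule S

attrs : List Rule → List ℕ
attrs S = deduplicate _≟_ (concatMap (λ r → map proj₁ (K r)) S)

nS : List Rule → ℕ
nS S = length (attrs S)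

maxList : List ℕ → ℕ
maxList = foldr _⊔_ 0

dS : List Rule → ℕ
dS S = maxList (map len S)

vals : List Rule → ℕ → List ℕ
vals S a = deduplicate _≟_ (map proj₂ (filter (λ e → proj₁ e ≟ a) (concatMap K S)))

-- k(S) = max |V_S(a)| over a ∈ A(S), and 0 when A(S) is empty
kS : List Rule → ℕ
kS S = maxList (map (λ a → length (vals S a)) (attrs S))

_⊂K_ : Rule → Rule → Set
r' ⊂K r = (∀ {e} → e ∈ K r' → e ∈ K r) × ¬ (∀ {e} → e ∈ K r → e ∈ K r')

SR-reduced : List Rule → Set
SR-reduced S = ∀ {r r'} → r ∈ S → r' ∈ S → ¬ (r' ⊂K r)

AD-reduced : List Rule → Set
AD-reduced S = ∀ {r r'} → r ∈ S → r' ∈ S → rhs r' ≡ rhs r → ¬ (r' ⊂K r)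

-- Equations with values in ω ∪ {*}: the value * is represented by nothing.

XEqn : Set
XEqn = ℕ × Maybe ℕ

Inconsistent : List XEqn → Set
Inconsistent L = Σ ℕ λ a → Σ (Maybe ℕ) λ v → Σ (Maybe ℕ) λ w →
  ((a , v) ∈ L) × ((a , w) ∈ L) × (v ≢ w)

Consistent : List XEqn → Set
Consistent L = ¬ Inconsistent L

embed : List Eqn → List XEqn
embed = map (λ e → proj₁ e , just (proj₂ e))

-- A working node labeled a_i has one outgoing edge for each admissible
-- edge label: the elements of V_S(a_i) (o-trees, labels `just δ`), or of
-- EV_S(a_i) = V_S(a_i) ∪ {*} (e-trees, with * = `nothing`).  The children
-- are given by a function on Maybe ℕ of which only the admissible labels
-- are part of the tree.

data Tree : Set where
  leaf : List Rule → Tree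
  node : ℕ → (Maybe ℕ → Tree) → Tree

data Kind : Set where
  o e : Kind

Edge : Kind → List Rule → ℕ → Maybe ℕ → Set
Edge o S a x = Σ ℕ λ δ → (x ≡ just δ) × (δ ∈ vals S a)
Edge e S a x = (x ≡ nothing) ⊎ (Σ ℕ λ δ → (x ≡ just δ) × (δ ∈ vals S a))

data IsTree (κ : Kind) (S : List Rule) : Tree → Set where
  leaf : ∀ {τ} → (∀ {r} → r ∈ τ → r ∈ S) → IsTree κ S (leaf τ)
  node : ∀ {a f} → a ∈ attrs S → (∀ x → Edge κ S a x → IsTree κ S (f x)) →
         IsTree κ S (node a f)

-- Complete paths: CPath κ S Γ Kξ τ h  says there is a complete path ξ of Γ
-- with K(ξ) = Kξ, τ(ξ) = τ and h(ξ) = h.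
data CPath (κ : Kind) (S : List Rule) : Tree → List XEqn → List Rule → ℕ → Set where
  leaf : ∀ {τ} → CPath κ S (leaf τ) [] τ 0
  node : ∀ {a f x Kξ τ h} → Edge κ S a x → CPath κ S (f x) Kξ τ h →
         CPath κ S (node a f) ((a , x) ∷ Kξ) τ (suc h)

Depth : Kind → List Rule → Tree → ℕ → Set
Depth κ S Γ m = (Σ (List XEqn) λ Kξ → Σ (List Rule) λ τ → CPath κ S Γ Kξ τ m)
              × (∀ {Kξ τ h} → CPath κ S Γ Kξ τ h → h ≤ m)

data Prob : Set where
  AR AD SR : Prob

Contained : List XEqn → Rule → Set
Contained Kξ r = ∀ {eq} → eq ∈ embed (K r) → eq ∈ Kξ

Cond : Prob → List Rule → List XEqn → List Rule → Set
Cond AR S Kξ τ = (∀ {r} → r ∈ τ → Contained Kξ r)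
  × (∀ {r} → r ∈ S → r ∉ τ → Inconsistent (embed (K r) ++ Kξ))
Cond AD S Kξ τ = (∀ {r} → r ∈ τ → Contained Kξ r)
  × (∀ {r} → r ∈ S → r ∉ τ → rhs r ∉ map rhs τ → Inconsistent (embed (K r) ++ Kξ))
Cond SR S Kξ τ = (∀ {r} → r ∈ τ → Contained Kξ r)
  × (τ ≡ [] → ∀ {r} → r ∈ S → Inconsistent (embed (K r) ++ Kξ))

data Cls : Set where
  SRc ESRc ADc EADc ARc EARc : Cls

kind : Cls → Kind
kind SRc = o
kind ESRc = e
kind ADc = o
kind EADc = e
kind ARc = o
kind EARc = e

prob : Cls → Prob
prob SRc = SR
prob ESRc = SR
prob ADc = AD
prob EADc = AD
prob ARc = AR
prob EARc = AR

Solves : Cls → List Rule → Tree → Set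
Solves C S Γ = IsTree (kind C) S Γ ×
  (∀ {Kξ τ h} → CPath (kind C) S Γ Kξ τ h → Consistent Kξ → Cond (prob C) S Kξ τ)

hC : Cls → List Rule → ℕ → Set
hC C S m = (Σ Tree λ Γ → Solves C S Γ × Depth (kind C) S Γ m)
         × (∀ Γ m' → Solves C S Γ → Depth (kind C) S Γ m' → m ≤ m')

-- H_C(n,d,k) = v, the maximum taken over systems satisfying P
-- (P = no restriction for H_C, SR-reduced / AD-reduced for H^R_C)
HMax : Cls → (List Rule → Set) → ℕ → ℕ → ℕ → ℕ → Set
HMax C P n d k v =
    (Σ (List Rule) λ S → IsSystem S × P S × nS S ≡ n × dS S ≡ d × kS S ≡ k × hC C S v)
  × (∀ S → IsSystem S → P S → nS S ≡ n → dS S ≡ d → kS S ≡ k →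
       Σ ℕ λ m → hC C S m × m ≤ v)

AnySys : List Rule → Set
AnySys _ = ⊤

srValue : ℕ → ℕ → ℕ → ℕ
srValue n (suc zero) k = 1
srValue n d (suc zero) = d
srValue n d k = n

-- Upper bounds come from trees querying a fixed list of attributes: all of A(S) solves every
-- problem; if d = 1, one query of any attribute already realizes a rule; if k = 1, querying the
-- attributes of one rule realizes it.  Lower bounds come from adversaries run on explicit systems
-- with the prescribed n, d and k: while some attribute is unasked, the answers leave a rule
-- consistent but unrealized, which the terminal label can neither include nor exclude (for AD
-- because the rule's right-hand side is unique).  For SR when d = 1 or k = 1 the adversary only
-- forces the d queries needed to realize a rule.

module Submission where

open import Defs
open import Data.Empty using (⊥; ⊥-elim)
open import Data.List using (List; []; _∷_; [_]; _++_; map; length; filter; concatMap; applyUpTo; upTo)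
open import Data.List.Membership.Propositional using (_∈_; _∉_; find; lose)
open import Data.List.Membership.Propositional.Properties
open import Data.List.Properties using (∷-injective; ++-assoc; ++-identityʳ; length-++; length-map; length-upTo)
  renaming (≡-dec to ≡-dec-List)
open import Data.List.Relation.Binary.Subset.Propositional using (_⊆_)
open import Data.List.Relation.Unary.All as All using (All; []; _∷_; all?)
open import Data.List.Relation.Unary.All.Properties using (++⁺)
open import Data.List.Relation.Unary.AllPairs as AllPairs using (AllPairs; []; _∷_)
open import Data.List.Relation.Unary.Any using (here; there; any?)
open import Data.List.Relation.Unary.Any.Properties using (¬Any[])
open import Data.List.Relation.Unary.Linked using (Linked; []; [-]; _∷_)
open import Data.List.Relation.Unary.Linked.Properties using (Linked⇒AllPairs)
open import Data.List.Relation.Unary.Unique.Propositional using (Unique)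
open import Data.List.Relation.Unary.Unique.Propositional.Properties using (upTo⁺)
open import Data.Maybe using (Maybe; just; nothing)
open import Data.Maybe.Properties using () renaming (≡-dec to ≡-dec-Maybe)
open import Data.Nat using (ℕ; zero; suc; _≤_; _<_; _+_; _∸_; z≤n; s≤s; z<s; _≤?_; _<?_)
open import Data.Nat.Properties
open import Data.List.Relation.Unary.Unique.DecPropositional.Properties _≟_ using (deduplicate-!)
open import Data.Product using (Σ; _×_; _,_; proj₁; proj₂)
open import Data.Product.Properties using () renaming (≡-dec to ≡-dec-×)
open import Data.Sum using (_⊎_; inj₁; inj₂; [_,_]′)
open import Data.Unit using (tt)
open import Relation.Binary.Definitions using (DecidableEquality)
open import Relation.Binary.PropositionalEquality
  using (_≡_; _≢_; refl; sym; trans; cong; subst)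
open import Relation.Nullary using (¬_; Dec; yes; no)
open import Relation.Nullary.Decidable using (map′; _×-dec_; _→-dec_; ¬?; decidable-stable)

Unique⇒length≤ : ∀ {A : Set} {xs ys : List A} → Unique xs → xs ⊆ ys → length xs ≤ length ys
Unique⇒length≤ {xs = []} _ _ = z≤n
Unique⇒length≤ {xs = x ∷ xs} (x∉xs ∷ uxs) xs⊆ys with ∈-∃++ (xs⊆ys (here refl))
... | ys₁ , ys₂ , refl = begin
    suc (length xs)               ≤⟨ s≤s (Unique⇒length≤ uxs xs⊆ys₁ys₂) ⟩
    suc (length (ys₁ ++ ys₂))     ≡⟨ cong suc (length-++ ys₁) ⟩
    suc (length ys₁ + length ys₂) ≡⟨ sym (+-suc (length ys₁) (length ys₂)) ⟩
    length ys₁ + length (x ∷ ys₂) ≡⟨ sym (length-++ ys₁) ⟩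
    length (ys₁ ++ x ∷ ys₂)       ∎
  where
  open ≤-Reasoning
  xs⊆ys₁ys₂ : xs ⊆ ys₁ ++ ys₂
  xs⊆ys₁ys₂ z∈xs with ∈-++⁻ ys₁ (xs⊆ys (there z∈xs))
  ... | inj₁ z∈ys₁ = ∈-++⁺ˡ z∈ys₁
  ... | inj₂ (here refl) = ⊥-elim (All.lookup x∉xs z∈xs refl)
  ... | inj₂ (there z∈ys₂) = ∈-++⁺ʳ ys₁ z∈ys₂

length≤-if-bounded : ∀ {xs : List ℕ} {n} → Unique xs → (∀ {a} → a ∈ xs → a < n) → length xs ≤ n
length≤-if-bounded {n = n} uxs bounded =
  subst (_ ≤_) (length-upTo n) (Unique⇒length≤ uxs (λ a∈ → ∈-upTo⁺ (bounded a∈)))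

length≥-if-covering : ∀ {xs : List ℕ} {n} → (∀ {a} → a < n → a ∈ xs) → n ≤ length xs
length≥-if-covering {n = n} covering =
  subst (_≤ _) (length-upTo n) (Unique⇒length≤ (upTo⁺ n) (λ a∈ → covering (∈-upTo⁻ a∈)))

maxList-upper : ∀ {x} xs → x ∈ xs → x ≤ maxList xs
maxList-upper (y ∷ xs) (here refl) = m≤m⊔n y (maxList xs)
maxList-upper (y ∷ xs) (there x∈) = ≤-trans (maxList-upper xs x∈) (m≤n⊔m y (maxList xs))

maxList-least : ∀ xs {M} → (∀ {x} → x ∈ xs → x ≤ M) → maxList xs ≤ M
maxList-least [] _ = z≤n
maxList-least (x ∷ xs) bounded = ⊔-lub (bounded (here refl)) (maxList-least xs (λ y∈ → bounded (there y∈)))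

maxList-≡ : ∀ xs {M} → (∀ {x} → x ∈ xs → x ≤ M) → (Σ ℕ λ x → x ∈ xs × M ≤ x) → maxList xs ≡ M
maxList-≡ xs bounded (x , x∈ , M≤x) = ≤-antisym (maxList-least xs bounded) (≤-trans M≤x (maxList-upper xs x∈))

module _ {P : ℕ → Set} (P? : ∀ n → Dec (P n)) where

  Least : ℕ → Set
  Least m = P m × (∀ {i} → P i → m ≤ i)

  least-below : ∀ j → (∀ {i} → i < j → ¬ P i) ⊎ Σ ℕ Least
  least-below zero = inj₁ (λ ())
  least-below (suc j) with least-below j
  ... | inj₂ least = inj₂ least
  ... | inj₁ none with P? j
  ...   | yes pj = inj₂ (j , pj , λ pi → ≮⇒≥ (λ i<j → none i<j pi))
  ...   | no ¬pj = inj₁ none′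
    where
    none′ : ∀ {i} → i < suc j → ¬ P i
    none′ i<1+j with m<1+n⇒m<n∨m≡n i<1+j
    ... | inj₁ i<j = none i<j
    ... | inj₂ refl = ¬pj

  least-witness : ∀ {j} → P j → Σ ℕ Least
  least-witness {j} pj with least-below (suc j)
  ... | inj₁ none = ⊥-elim (none (n<1+n j) pj)
  ... | inj₂ least = least

Linked<⇒Unique : ∀ {xs : List ℕ} → Linked _<_ xs → Unique xs
Linked<⇒Unique l = AllPairs.map (λ x<y x≡y → <-irrefl x≡y x<y) (Linked⇒AllPairs <-trans l)

keys-functional : ∀ {L : List Eqn} → AllPairs _<_ (map proj₁ L) → ∀ {a v w} → (a , v) ∈ L → (a , w) ∈ L → v ≡ w
keys-functional _ (here refl) (here refl) = refl
keys-functional (a<L ∷ _) (here refl) (there aw∈) = ⊥-elim (<-irrefl refl (All.lookup a<L (∈-map⁺ proj₁ aw∈)))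
keys-functional (a<L ∷ _) (there av∈) (here refl) = ⊥-elim (<-irrefl refl (All.lookup a<L (∈-map⁺ proj₁ av∈)))
keys-functional (_ ∷ L<) (there av∈) (there aw∈) = keys-functional L< av∈ aw∈

ValidRule⇒functional : ∀ {r} → ValidRule r → ∀ {a v w} → (a , v) ∈ K r → (a , w) ∈ K r → v ≡ w
ValidRule⇒functional valid = keys-functional (Linked⇒AllPairs <-trans valid)

∈-attrs⁺ : ∀ {S r a v} → r ∈ S → (a , v) ∈ K r → a ∈ attrs S
∈-attrs⁺ r∈S av∈r = ∈-deduplicate⁺ _≟_ (∈-concatMap⁺ (λ r → map proj₁ (K r)) (lose r∈S (∈-map⁺ proj₁ av∈r)))

∈-attrs⁻ : ∀ {S a} → a ∈ attrs S → Σ Rule λ r → r ∈ S × Σ ℕ λ v → (a , v) ∈ K r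
∈-attrs⁻ {S} a∈ with find (∈-concatMap⁻ (λ r → map proj₁ (K r)) {xs = S} (∈-deduplicate⁻ _≟_ _ a∈))
... | r , r∈S , a∈r with ∈-map⁻ proj₁ a∈r
... | (_ , v) , av∈r , refl = r , r∈S , v , av∈r

∈-vals⁺ : ∀ {S r a v} → r ∈ S → (a , v) ∈ K r → v ∈ vals S a
∈-vals⁺ {a = a} r∈S av∈r =
  ∈-deduplicate⁺ _≟_ (∈-map⁺ proj₂ (∈-filter⁺ (λ ε → proj₁ ε ≟ a) (∈-concatMap⁺ K (lose r∈S av∈r)) refl))

∈-vals⁻ : ∀ {S a v} → v ∈ vals S a → Σ Rule λ r → r ∈ S × (a , v) ∈ K r
∈-vals⁻ {S} {a} v∈ with ∈-map⁻ proj₂ (∈-deduplicate⁻ _≟_ _ v∈)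
... | ε , ε∈ , refl with ∈-filter⁻ (λ ε → proj₁ ε ≟ a) {xs = concatMap K S} ε∈
... | ε∈S , refl with find (∈-concatMap⁻ K {xs = S} ε∈S)
... | r , r∈S , ε∈r = r , r∈S , ε∈r

attrs-unique : ∀ S → Unique (attrs S)
attrs-unique S = deduplicate-! _

vals-unique : ∀ S a → Unique (vals S a)
vals-unique S a = deduplicate-! _

len≤dS : ∀ {S r} → r ∈ S → len r ≤ dS S
len≤dS {S} r∈S = maxList-upper (map len S) (∈-map⁺ len r∈S)

vals≤kS : ∀ {S a} → a ∈ attrs S → length (vals S a) ≤ kS S
vals≤kS {S} a∈ = maxList-upper (map (λ a → length (vals S a)) (attrs S)) (∈-map⁺ (λ a → length (vals S a)) a∈)

∈-embed⁺ : ∀ {L : List Eqn} {a δ} → (a , δ) ∈ L → (a , just δ) ∈ embed L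
∈-embed⁺ = ∈-map⁺ (λ ε → proj₁ ε , just (proj₂ ε))

∈-embed⁻ : ∀ {L : List Eqn} {a x} → (a , x) ∈ embed L → Σ ℕ λ δ → x ≡ just δ × (a , δ) ∈ L
∈-embed⁻ ax∈ with ∈-map⁻ (λ ε → proj₁ ε , just (proj₂ ε)) ax∈
... | (_ , δ) , aδ∈ , refl = δ , refl , aδ∈

_≟ₓ_ : DecidableEquality XEqn
_≟ₓ_ = ≡-dec-× _≟_ (≡-dec-Maybe _≟_)

_≟ᵣ_ : DecidableEquality Rule
_≟ᵣ_ = ≡-dec-× (≡-dec-List (≡-dec-× _≟_ _≟_)) _≟_

open import Data.List.Membership.DecPropositional _≟ₓ_ using () renaming (_∈?_ to _∈ₓ?_)
open import Data.List.Membership.DecPropositional _≟ᵣ_ using () renaming (_∈?_ to _∈ᵣ?_)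
open import Data.List.Membership.DecPropositional _≟_ using () renaming (_∈?_ to _∈ℕ?_)
open import Data.List.Membership.DecPropositional (≡-dec-Maybe _≟_) using () renaming (_∈?_ to _∈ₘ?_)

all∈? : ∀ {A : Set} {P : A → Set} → (∀ x → Dec (P x)) → ∀ xs → Dec (∀ {x} → x ∈ xs → P x)
all∈? P? xs = map′ All.lookup All.tabulate (all? P? xs)

any∈? : ∀ {A : Set} {P : A → Set} → (∀ x → Dec (P x)) → ∀ xs → Dec (Σ A λ x → x ∈ xs × P x)
any∈? P? xs = map′ find (λ (x , x∈ , px) → lose x∈ px) (any? P? xs)

inconsistent? : ∀ L → Dec (Inconsistent L)
inconsistent? L =
  map′ (λ { ((a , v) , av∈ , (_ , w) , aw∈ , refl , v≢w) → a , v , w , av∈ , aw∈ , v≢w })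
       (λ (a , v , w , av∈ , aw∈ , v≢w) → (a , v) , av∈ , (a , w) , aw∈ , refl , v≢w)
       (any∈? (λ ε → any∈? (λ ε′ → (proj₁ ε ≟ proj₁ ε′) ×-dec ¬? (≡-dec-Maybe _≟_ (proj₂ ε) (proj₂ ε′))) L) L)

consistent? : ∀ L → Dec (Consistent L)
consistent? L = ¬? (inconsistent? L)

contained? : ∀ Kξ r → Dec (Contained Kξ r)
contained? Kξ r = all∈? (_∈ₓ? Kξ) (embed (K r))

cond? : ∀ P S Kξ τ → Dec (Cond P S Kξ τ)
cond? AR S Kξ τ = all∈? (contained? Kξ) τ
  ×-dec all∈? (λ r → ¬? (r ∈ᵣ? τ) →-dec inconsistent? (embed (K r) ++ Kξ)) S
cond? AD S Kξ τ = all∈? (contained? Kξ) τ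
  ×-dec all∈? (λ r → ¬? (r ∈ᵣ? τ) →-dec ¬? (rhs r ∈ℕ? map rhs τ) →-dec inconsistent? (embed (K r) ++ Kξ)) S
cond? SR S Kξ τ = all∈? (contained? Kξ) τ
  ×-dec (≡-dec-List _≟ᵣ_ τ [] →-dec all∈? (λ r → inconsistent? (embed (K r) ++ Kξ)) S)

edges : Kind → List Rule → ℕ → List (Maybe ℕ)
edges o S a = map just (vals S a)
edges e S a = nothing ∷ map just (vals S a)

Edge⇒∈edges : ∀ {κ S a x} → Edge κ S a x → x ∈ edges κ S a
Edge⇒∈edges {o} (δ , refl , δ∈) = ∈-map⁺ just δ∈
Edge⇒∈edges {e} (inj₁ refl) = here refl
Edge⇒∈edges {e} (inj₂ (δ , refl , δ∈)) = there (∈-map⁺ just δ∈)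

∈edges⇒Edge : ∀ κ {S a x} → x ∈ edges κ S a → Edge κ S a x
∈edges⇒Edge o x∈ with ∈-map⁻ just x∈
... | δ , δ∈ , refl = δ , refl , δ∈
∈edges⇒Edge e (here refl) = inj₁ refl
∈edges⇒Edge e (there x∈) with ∈-map⁻ just x∈
... | δ , δ∈ , refl = inj₂ (δ , refl , δ∈)

value-edge : ∀ κ {S a δ} → δ ∈ vals S a → Edge κ S a (just δ)
value-edge o δ∈ = _ , refl , δ∈
value-edge e δ∈ = inj₂ (_ , refl , δ∈)

edges-nonempty : ∀ κ {S a} → a ∈ attrs S → Σ (Maybe ℕ) λ x → x ∈ edges κ S a
edges-nonempty κ {S} a∈ with ∈-attrs⁻ {S} a∈
... | r , r∈S , v , av∈r = just v , Edge⇒∈edges {κ} (value-edge κ (∈-vals⁺ {S} r∈S av∈r))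

max-attained : ∀ {A : Set} (xs : List A) {x₀ : A} → x₀ ∈ xs → (g : ∀ x → x ∈ xs → ℕ) →
  Σ ℕ λ M → (Σ A λ x → Σ (x ∈ xs) λ x∈ → g x x∈ ≡ M) × (∀ x (x∈ : x ∈ xs) → g x x∈ ≤ M)
max-attained (y ∷ []) _ g = g y (here refl) , (y , here refl , refl) , λ { _ (here refl) → ≤-refl }
max-attained (y ∷ y′ ∷ ys) _ g with max-attained (y′ ∷ ys) (here refl) (λ x x∈ → g x (there x∈))
... | M , (x , x∈ , gx≡M) , bounded with g y (here refl) ≤? M
...   | yes gy≤M = M , (x , there x∈ , gx≡M) , λ { _ (here refl) → gy≤M ; z (there z∈) → bounded z z∈ }
...   | no gy≰M = g y (here refl) , (y , here refl , refl) ,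
                   λ { _ (here refl) → ≤-refl ; x (there x∈) → ≤-trans (bounded x x∈) (<⇒≤ (≰⇒> gy≰M)) }

depth-exists : ∀ {κ S Γ} → IsTree κ S Γ → Σ ℕ λ m → Depth κ S Γ m
depth-exists (leaf _) = 0 , ([] , _ , leaf) , λ { leaf → z≤n }
depth-exists {κ} {S} (node {a} {f} a∈ child) with edges-nonempty κ a∈
... | x₀ , x₀∈ with max-attained (edges κ S a) x₀∈ (λ x x∈ → proj₁ (depth-of x x∈))
  where
  depth-of : ∀ x → x ∈ edges κ S a → Σ ℕ λ m → Depth κ S (f x) m
  depth-of x x∈ = depth-exists (child x (∈edges⇒Edge κ x∈))
... | M , (x , x∈ , depth-x≡M) , bounded with depth-exists (child x (∈edges⇒Edge κ x∈))
... | _ , (Kξ , τ , deepest) , _ =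
  suc M , ((a , x) ∷ Kξ , τ , node (∈edges⇒Edge κ x∈) (subst (CPath κ S (f x) Kξ τ) depth-x≡M deepest)) , below
  where
  below : ∀ {Kξ τ h} → CPath κ S (node a f) Kξ τ h → h ≤ suc M
  below (node {x = y} y-edge path) =
    s≤s (≤-trans (proj₂ (proj₂ (depth-exists (child y (∈edges⇒Edge κ (Edge⇒∈edges y-edge))))) path)
                 (bounded y (Edge⇒∈edges y-edge)))

realized : List Rule → List XEqn → List Rule
realized S p = filter (contained? p) S

realized⊆ : ∀ S p → realized S p ⊆ S
realized⊆ S p r∈ = proj₁ (∈-filter⁻ (contained? p) {xs = S} r∈)

realized-contained : ∀ S p {r} → r ∈ realized S p → Contained p r
realized-contained S p r∈ = proj₂ (∈-filter⁻ (contained? p) {xs = S} r∈)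

Cond-contained : ∀ P {S Kξ τ} → Cond P S Kξ τ → ∀ {r} → r ∈ τ → Contained Kξ r
Cond-contained AR = proj₁
Cond-contained AD = proj₁
Cond-contained SR = proj₁

-- Minimum depths exist because solvability within depth j is decidable: a solving tree is either a
-- leaf, for which the realized rules are the best label, or a query followed, for every answer, by
-- a tree of smaller depth solving the problem once the answers p so far are extended by it.
module Search (κ : Kind) (P : Prob) (S : List Rule) where

  DepthAtMost : Tree → ℕ → Set
  DepthAtMost Γ j = ∀ {Kξ τ h} → CPath κ S Γ Kξ τ h → h ≤ j

  SolvesBelow : List XEqn → Tree → Set
  SolvesBelow p Γ = ∀ {Kξ τ h} → CPath κ S Γ Kξ τ h → Consistent (p ++ Kξ) → Cond P S (p ++ Kξ) τ

  Solvable : List XEqn → ℕ → Set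
  Solvable p j = Σ Tree λ Γ → IsTree κ S Γ × DepthAtMost Γ j × SolvesBelow p Γ

  LeafSolves : List XEqn → Set
  LeafSolves p = Σ (List Rule) λ τ → τ ⊆ S × (Consistent p → Cond P S p τ)

  QueryStep : List XEqn → ℕ → Set
  QueryStep p j = Σ ℕ λ a → a ∈ attrs S × (∀ {x} → x ∈ edges κ S a → Solvable (p ++ [ (a , x) ]) j)

  realized-maximal : ∀ {p τ} → τ ⊆ S → Cond P S p τ → Cond P S p (realized S p)
  realized-maximal {p} {τ} τ⊆S cond = go P cond
    where
    τ⊆realized : τ ⊆ realized S p
    τ⊆realized r∈τ = ∈-filter⁺ (contained? p) (τ⊆S r∈τ) (Cond-contained P cond r∈τ)
    contained : ∀ {r} → r ∈ realized S p → Contained p r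
    contained = realized-contained S p
    go : ∀ P → Cond P S p τ → Cond P S p (realized S p)
    go AR (_ , inconsistent) = contained , λ r∈S r∉ → inconsistent r∈S (λ r∈τ → r∉ (τ⊆realized r∈τ))
    go AD (_ , inconsistent) = contained , λ r∈S r∉ rhs∉ → inconsistent r∈S (λ r∈τ → r∉ (τ⊆realized r∈τ))
      (λ rhs∈ → let (r′ , r′∈τ , rhs≡) = ∈-map⁻ rhs rhs∈ in
                rhs∉ (subst (_∈ map rhs (realized S p)) (sym rhs≡) (∈-map⁺ rhs (τ⊆realized r′∈τ))))
    go SR (_ , inconsistent) = contained , λ realized≡[] → inconsistent (τ-empty τ τ⊆realized realized≡[])
      where
      τ-empty : ∀ τ → τ ⊆ realized S p → realized S p ≡ [] → τ ≡ []
      τ-empty [] _ _ = refl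
      τ-empty (r ∷ _) ⊆realized realized≡[] with subst (r ∈_) realized≡[] (⊆realized (here refl))
      ... | ()

  leafSolves? : ∀ p → Dec (LeafSolves p)
  leafSolves? p with consistent? p
  ... | no inconsistent = yes ([] , (λ ()) , λ consistent → ⊥-elim (inconsistent consistent))
  ... | yes consistent with cond? P S p (realized S p)
  ...   | yes cond = yes (realized S p , (realized⊆ S p) , λ _ → cond)
  ...   | no ¬cond = no (λ (τ , τ⊆S , solves) → ¬cond (realized-maximal τ⊆S (solves consistent)))

  leaf-solvable : ∀ {p j} → LeafSolves p → Solvable p j
  leaf-solvable {p} (τ , τ⊆S , solves) = leaf τ , leaf τ⊆S , (λ { leaf → z≤n }) ,
    λ { leaf consistent → subst (λ L → Cond P S L τ) (sym (++-identityʳ p))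
                                (solves (subst Consistent (++-identityʳ p) consistent)) }

  solvable-inversion : ∀ p j → Solvable p j → LeafSolves p ⊎ Σ ℕ λ j′ → j ≡ suc j′ × QueryStep p j′
  solvable-inversion p j (leaf τ , leaf τ⊆S , _ , solves) =
    inj₁ (τ , τ⊆S , λ consistent → subst (λ L → Cond P S L τ) (++-identityʳ p)
                                          (solves leaf (subst Consistent (sym (++-identityʳ p)) consistent)))
  solvable-inversion p zero (node a f , node a∈ child , shallow , _) with edges-nonempty κ a∈
  ... | x , x∈ with depth-exists (child x (∈edges⇒Edge κ x∈))
  ...   | _ , (_ , _ , path) , _ with shallow (node (∈edges⇒Edge κ x∈) path)
  ...     | ()
  solvable-inversion p (suc j) (node a f , node a∈ child , shallow , solves) =
    inj₂ (j , refl , a , a∈ , λ {x} x∈ → f x , child x (∈edges⇒Edge κ x∈) ,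
      (λ path → ≤-pred (shallow (node (∈edges⇒Edge κ x∈) path))) ,
      λ {Kξ} {τ} path consistent → subst (λ L → Cond P S L τ) (sym (++-assoc p [ (a , x) ] Kξ))
        (solves (node (∈edges⇒Edge κ x∈) path) (subst Consistent (++-assoc p [ (a , x) ] Kξ) consistent)))

  step-solvable : ∀ p j → QueryStep p j → Solvable p (suc j)
  step-solvable p j (a , a∈ , subtree) = node a f , node a∈ (λ x edge → proj₁ (f-ok x (Edge⇒∈edges edge))) ,
    shallow , solves
    where
    pick : ∀ x → Dec (x ∈ edges κ S a) → Tree
    pick x (yes x∈) = proj₁ (subtree x∈)
    pick x (no _) = leaf []
    f : Maybe ℕ → Tree
    f x = pick x (x ∈ₘ? edges κ S a)
    pick-ok : ∀ x (x∈? : Dec (x ∈ edges κ S a)) → x ∈ edges κ S a →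
      IsTree κ S (pick x x∈?) × DepthAtMost (pick x x∈?) j × SolvesBelow (p ++ [ (a , x) ]) (pick x x∈?)
    pick-ok x (yes x∈) _ = proj₂ (subtree x∈)
    pick-ok x (no x∉) x∈ = ⊥-elim (x∉ x∈)
    f-ok : ∀ x → x ∈ edges κ S a → IsTree κ S (f x) × DepthAtMost (f x) j × SolvesBelow (p ++ [ (a , x) ]) (f x)
    f-ok x = pick-ok x (x ∈ₘ? edges κ S a)
    shallow : DepthAtMost (node a f) (suc j)
    shallow (node {x = x} edge path) = s≤s (proj₁ (proj₂ (f-ok x (Edge⇒∈edges edge))) path)
    solves : SolvesBelow p (node a f)
    solves (node {x = x} {Kξ = Kξ} {τ = τ} edge path) consistent =
      subst (λ L → Cond P S L τ) (++-assoc p [ (a , x) ] Kξ)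
        (proj₂ (proj₂ (f-ok x (Edge⇒∈edges edge))) path (subst Consistent (sym (++-assoc p [ (a , x) ] Kξ)) consistent))

  solvable? : ∀ j p → Dec (Solvable p j)
  solvable? j p with leafSolves? p
  ... | yes leafSolves = yes (leaf-solvable leafSolves)
  solvable? zero p | no ¬leafSolves = no λ solvable → case (solvable-inversion p zero solvable)
    where
    case : LeafSolves p ⊎ Σ ℕ (λ j′ → zero ≡ suc j′ × QueryStep p j′) → ⊥
    case (inj₁ leafSolves) = ¬leafSolves leafSolves
    case (inj₂ (_ , () , _))
  solvable? (suc j) p | no ¬leafSolves
    with any∈? (λ a → all∈? (λ x → solvable? j (p ++ [ (a , x) ])) (edges κ S a)) (attrs S)
  ... | yes step = yes (step-solvable p j step)
  ... | no ¬step = no λ solvable → case (solvable-inversion p (suc j) solvable)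
    where
    case : LeafSolves p ⊎ Σ ℕ (λ j′ → suc j ≡ suc j′ × QueryStep p j′) → ⊥
    case (inj₁ leafSolves) = ¬leafSolves leafSolves
    case (inj₂ (_ , refl , step)) = ¬step step

hC-≤ : ∀ C {S Γ j} → Solves C S Γ → (∀ {Kξ τ h} → CPath (kind C) S Γ Kξ τ h → h ≤ j) → Σ ℕ λ m → hC C S m × m ≤ j
hC-≤ C {S} {Γ} (isTree , solves) shallow
  with least-witness (λ m → solvable? m []) (Γ , isTree , shallow , solves)
  where open Search (kind C) (prob C) S
... | m , (Γ′ , isTree′ , shallow′ , solves′) , least with depth-exists isTree′
... | m′ , depth with ≤-antisym (least (Γ′ , isTree′ , proj₂ depth , solves′)) (shallow′ (proj₂ (proj₂ (proj₁ depth))))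
... | refl = m , ((Γ′ , (isTree′ , solves′) , depth) ,
                  λ Γ″ m″ (isTree″ , solves″) depth″ → least (Γ″ , isTree″ , proj₂ depth″ , solves″)) ,
             least (Γ , isTree , shallow , solves)

queryTree : List Rule → List ℕ → List XEqn → Tree
queryTree S [] p = leaf (realized S p)
queryTree S (a ∷ as) p = node a (λ x → queryTree S as (p ++ [ (a , x) ]))

queryTree-isTree : ∀ κ S as p → (∀ {a} → a ∈ as → a ∈ attrs S) → IsTree κ S (queryTree S as p)
queryTree-isTree κ S [] p _ = leaf (realized⊆ S p)
queryTree-isTree κ S (a ∷ as) p as⊆ = node (as⊆ (here refl)) (λ x _ → queryTree-isTree κ S as _ (λ b∈ → as⊆ (there b∈)))

AnswerEdges : Kind → List Rule → List XEqn → Set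
AnswerEdges κ S = All (λ (a , x) → Edge κ S a x)

queryTree-path : ∀ κ S as p {Kξ τ h} → CPath κ S (queryTree S as p) Kξ τ h →
  τ ≡ realized S (p ++ Kξ) × h ≡ length as × map proj₁ Kξ ≡ as × AnswerEdges κ S Kξ
queryTree-path κ S [] p leaf = cong (realized S) (sym (++-identityʳ p)) , refl , refl , []
queryTree-path κ S (a ∷ as) p (node {x = x} {Kξ = Kξ} edge path) with queryTree-path κ S as (p ++ [ (a , x) ]) path
... | τ≡ , h≡ , keys≡ , answers =
  trans τ≡ (cong (realized S) (++-assoc p [ (a , x) ] Kξ)) , cong suc h≡ , cong (a ∷_) keys≡ , edge ∷ answers

queryTree-solves : ∀ C S as → (∀ {a} → a ∈ as → a ∈ attrs S) →
  (∀ Kξ → map proj₁ Kξ ≡ as → AnswerEdges (kind C) S Kξ → Consistent Kξ → Cond (prob C) S Kξ (realized S Kξ)) →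
  Solves C S (queryTree S as [])
queryTree-solves C S as as⊆ solves = queryTree-isTree (kind C) S as [] as⊆ , λ {Kξ} path consistent →
  let (τ≡ , _ , keys≡ , answers) = queryTree-path (kind C) S as [] path in
  subst (Cond (prob C) S Kξ) (sym τ≡) (solves Kξ keys≡ answers consistent)

queryTree-depth : ∀ κ S as {Kξ τ h} → CPath κ S (queryTree S as []) Kξ τ h → h ≤ length as
queryTree-depth κ S as path = ≤-reflexive (proj₁ (proj₂ (queryTree-path κ S as [] path)))

decided⇒Cond : ∀ P S Kξ → (∀ {r} → r ∈ S → Contained Kξ r ⊎ Inconsistent (embed (K r) ++ Kξ)) →
  Cond P S Kξ (realized S Kξ)
decided⇒Cond P S Kξ decided = go P
  where
  inconsistent : ∀ {r} → r ∈ S → r ∉ realized S Kξ → Inconsistent (embed (K r) ++ Kξ)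
  inconsistent r∈S r∉ with decided r∈S
  ... | inj₁ contained = ⊥-elim (r∉ (∈-filter⁺ (contained? Kξ) r∈S contained))
  ... | inj₂ inconsistent = inconsistent
  go : ∀ P → Cond P S Kξ (realized S Kξ)
  go AR = realized-contained S Kξ , inconsistent
  go AD = realized-contained S Kξ , λ r∈S r∉ _ → inconsistent r∈S r∉
  go SR = realized-contained S Kξ , λ realized≡[] r∈S → inconsistent r∈S (λ r∈ → ¬Any[] (subst (_ ∈_) realized≡[] r∈))

¬Contained⇒missing : ∀ Kξ r → ¬ Contained Kξ r → Σ XEqn λ ε → ε ∈ embed (K r) × ε ∉ Kξ
¬Contained⇒missing Kξ r ¬contained with any∈? (λ ε → ¬? (ε ∈ₓ? Kξ)) (embed (K r))
... | yes missing = missing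
... | no ¬missing = ⊥-elim (¬contained λ {ε} ε∈ → decidable-stable (ε ∈ₓ? Kξ) (λ ε∉ → ¬missing (ε , ε∈ , ε∉)))

queryAll-solves : ∀ C S → Solves C S (queryTree S (attrs S) [])
queryAll-solves C S = queryTree-solves C S (attrs S) (λ a∈ → a∈)
  λ Kξ keys≡ _ _ → decided⇒Cond (prob C) S Kξ (decided Kξ keys≡)
  where
  decided : ∀ Kξ → map proj₁ Kξ ≡ attrs S → ∀ {r} → r ∈ S → Contained Kξ r ⊎ Inconsistent (embed (K r) ++ Kξ)
  decided Kξ keys≡ {r} r∈S with contained? Kξ r
  ... | yes contained = inj₁ contained
  ... | no ¬contained with ¬Contained⇒missing Kξ r ¬contained
  ... | (a , x) , ax∈r , ax∉ with ∈-embed⁻ {K r} ax∈r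
  ... | δ , refl , aδ∈r with ∈-map⁻ proj₁ (subst (a ∈_) (sym keys≡) (∈-attrs⁺ {S} r∈S aδ∈r))
  ... | (_ , y) , ay∈ , refl =
    inj₂ (a , just δ , y , ∈-++⁺ˡ ax∈r , ∈-++⁺ʳ (embed (K r)) ay∈ ,
          λ δ≡y → ax∉ (subst (λ z → (a , z) ∈ Kξ) (sym δ≡y) ay∈))

Contained⇒CondSR : ∀ S Kξ {r} → r ∈ S → Contained Kξ r → Cond SR S Kξ (realized S Kξ)
Contained⇒CondSR S Kξ r∈S contained = realized-contained S Kξ ,
  λ realized≡[] → ⊥-elim (¬Any[] (subst (_ ∈_) realized≡[] (∈-filter⁺ (contained? Kξ) r∈S contained)))

hC≤nS : ∀ C S → Σ ℕ λ m → hC C S m × m ≤ nS S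
hC≤nS C S = hC-≤ C (queryAll-solves C S) (queryTree-depth (kind C) S (attrs S))

∈-length≤1⇒≡[_] : ∀ {A : Set} {x : A} {xs} → x ∈ xs → length xs ≤ 1 → xs ≡ [ x ]
∈-length≤1⇒≡[_] {xs = _ ∷ []} (here refl) _ = refl
∈-length≤1⇒≡[_] {xs = _ ∷ _ ∷ _} _ (s≤s ())

hSR≤1 : ∀ {S a} → a ∈ attrs S → dS S ≤ 1 → Σ ℕ λ m → hC SRc S m × m ≤ 1
hSR≤1 {S} {a} a∈ dS≤1 =
  hC-≤ SRc (queryTree-solves SRc S [ a ] (λ { (here refl) → a∈ }) solves) (queryTree-depth o S [ a ])
  where
  solves : ∀ Kξ → map proj₁ Kξ ≡ [ a ] → AnswerEdges o S Kξ → Consistent Kξ → Cond SR S Kξ (realized S Kξ)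
  solves (_ ∷ []) refl ((δ , refl , δ∈) ∷ []) _ with ∈-vals⁻ {S} δ∈
  ... | r , r∈S , aδ∈r = Contained⇒CondSR S _ r∈S
    (λ ε∈ → subst (λ L → _ ∈ embed L) (∈-length≤1⇒≡[_] aδ∈r (≤-trans (len≤dS r∈S) dS≤1)) ε∈)

answers-agree : ∀ S (L : List Eqn) Kξ → map proj₁ Kξ ≡ map proj₁ L → AnswerEdges o S Kξ →
  (∀ {a δ} → (a , δ) ∈ L → ∀ {δ′} → δ′ ∈ vals S a → δ′ ≡ δ) → embed L ⊆ Kξ
answers-agree S ((a , δ) ∷ L) ((_ , x) ∷ Kξ) keys≡ ((δ′ , refl , δ′∈) ∷ answers) only-value ε∈
  with ∷-injective keys≡
answers-agree S ((a , δ) ∷ L) ((_ , x) ∷ Kξ) keys≡ ((δ′ , refl , δ′∈) ∷ answers) only-value (here refl)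
  | refl , _ = here (cong (λ z → a , just z) (sym (only-value (here refl) δ′∈)))
answers-agree S ((a , δ) ∷ L) ((_ , x) ∷ Kξ) keys≡ ((δ′ , refl , δ′∈) ∷ answers) only-value (there ε∈)
  | refl , keys≡′ = there (answers-agree S L Kξ keys≡′ answers (λ aδ∈ → only-value (there aδ∈)) ε∈)

hSR≤dS : ∀ {S r} → r ∈ S → kS S ≤ 1 → Σ ℕ λ m → hC SRc S m × m ≤ dS S
hSR≤dS {S} {r} r∈S kS≤1 with hC-≤ SRc (queryTree-solves SRc S (map proj₁ (K r)) keys⊆ solves) shallow
  where
  keys⊆ : ∀ {a} → a ∈ map proj₁ (K r) → a ∈ attrs S
  keys⊆ a∈ with ∈-map⁻ proj₁ a∈
  ... | _ , av∈r , refl = ∈-attrs⁺ {S} r∈S av∈r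
  only-value : ∀ {a δ} → (a , δ) ∈ K r → ∀ {δ′} → δ′ ∈ vals S a → δ′ ≡ δ
  only-value aδ∈r δ′∈ with ∈-length≤1⇒≡[_] (∈-vals⁺ {S} r∈S aδ∈r)
                                          (≤-trans (vals≤kS {S} (∈-attrs⁺ {S} r∈S aδ∈r)) kS≤1)
  ... | vals≡ with subst (_ ∈_) vals≡ δ′∈
  ... | here δ′≡δ = δ′≡δ
  solves : ∀ Kξ → map proj₁ Kξ ≡ map proj₁ (K r) → AnswerEdges o S Kξ → Consistent Kξ → Cond SR S Kξ (realized S Kξ)
  solves Kξ keys≡ answers _ = Contained⇒CondSR S Kξ r∈S (answers-agree S (K r) Kξ keys≡ answers only-value)
  shallow : ∀ {Kξ τ h} → CPath o S (queryTree S (map proj₁ (K r)) []) Kξ τ h → h ≤ len r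
  shallow path = ≤-trans (queryTree-depth o S _ path) (≤-reflexive (length-map proj₁ (K r)))
... | m , hC-m , m≤len = m , hC-m , ≤-trans m≤len (len≤dS r∈S)

hC-exact : ∀ C S v → (Σ ℕ λ m → hC C S m × m ≤ v) →
  (∀ Γ m → Solves C S Γ → Depth (kind C) S Γ m → v ≤ m) → hC C S v
hC-exact C S v (m , ((Γ , solves , depth) , least) , m≤v) lower with ≤-antisym m≤v (lower Γ m solves depth)
... | refl = (Γ , solves , depth) , least

hC≡nS : ∀ C S {n} → nS S ≡ n → (∀ Γ h → Solves C S Γ → Depth (kind C) S Γ h → n ≤ h) → hC C S n
hC≡nS C S refl lower = hC-exact C S (nS S) (hC≤nS C S) lower

record Adversary (C : Cls) (S : List Rule) : Set₁ where
  field
    answer : List XEqn → ℕ → Maybe ℕ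
    Invariant : List XEqn → Set
    invariant-[] : Invariant []
    step : ∀ p {a} → a ∈ attrs S → Invariant p →
           Edge (kind C) S a (answer p a) × Invariant (p ++ [ (a , answer p a) ])
    consistent : ∀ {p} → Invariant p → Consistent p

module _ {C S} (A : Adversary C S) where
  open Adversary A

  adversary-path : ∀ {Γ} → IsTree (kind C) S Γ → ∀ p → Invariant p →
    Σ (List XEqn) λ Kξ → Σ (List Rule) λ τ → CPath (kind C) S Γ Kξ τ (length Kξ) × Invariant (p ++ Kξ) × τ ⊆ S
  adversary-path (leaf τ⊆S) p inv = [] , _ , leaf , subst Invariant (sym (++-identityʳ p)) inv , τ⊆S
  adversary-path (node {a} a∈ child) p inv with step p a∈ inv
  ... | edge , inv′ with adversary-path (child (answer p a) edge) (p ++ [ (a , answer p a) ]) inv′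
  ... | Kξ , τ , path , inv″ , τ⊆S =
    (a , answer p a) ∷ Kξ , τ , node edge path , subst Invariant (++-assoc p [ (a , answer p a) ] Kξ) inv″ , τ⊆S

  adversary-lower-bound : ∀ B → (∀ Kξ τ → Invariant Kξ → τ ⊆ S → Cond (prob C) S Kξ τ → B ≤ length Kξ) →
    ∀ Γ m → Solves C S Γ → Depth (kind C) S Γ m → B ≤ m
  adversary-lower-bound B long Γ m (isTree , solves) (_ , deepest) with adversary-path isTree [] invariant-[]
  ... | Kξ , τ , path , inv , τ⊆S = ≤-trans (long Kξ τ inv τ⊆S (solves path (consistent inv))) (deepest path)

  adversary⇒nS≤depth :
    (∀ Kξ → Invariant Kξ → ∀ {a} → a ∈ attrs S → a ∉ map proj₁ Kξ → ∀ τ → τ ⊆ S → ¬ Cond (prob C) S Kξ τ) →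
    ∀ Γ m → Solves C S Γ → Depth (kind C) S Γ m → nS S ≤ m
  adversary⇒nS≤depth unanswered⇒¬Cond = adversary-lower-bound (nS S) long
    where
    long : ∀ Kξ τ → Invariant Kξ → τ ⊆ S → Cond (prob C) S Kξ τ → nS S ≤ length Kξ
    long Kξ τ inv τ⊆S cond =
      subst (_ ≤_) (length-map proj₁ Kξ) (Unique⇒length≤ (attrs-unique S) all-answered)
      where
      all-answered : attrs S ⊆ map proj₁ Kξ
      all-answered {a} a∈ with a ∈ℕ? map proj₁ Kξ
      ... | yes answered = answered
      ... | no unanswered = ⊥-elim (unanswered⇒¬Cond Kξ inv a∈ unanswered τ τ⊆S cond)

noneContained⇒¬Cond : ∀ P S Kξ τ → τ ⊆ S → (∀ {r} → r ∈ S → ¬ Contained Kξ r) →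
  (Σ Rule λ r → r ∈ S × Consistent (embed (K r) ++ Kξ)) → ¬ Cond P S Kξ τ
noneContained⇒¬Cond P S Kξ τ τ⊆S noneContained (r , r∈S , consistent) cond = go P cond
  where
  τ-empty : ∀ P → Cond P S Kξ τ → ∀ {r} → r ∉ τ
  τ-empty P cond r∈τ = noneContained (τ⊆S r∈τ) (Cond-contained P cond r∈τ)
  go : ∀ P → Cond P S Kξ τ → ⊥
  go AR cond@(_ , inconsistent) = consistent (inconsistent r∈S (τ-empty AR cond))
  go AD cond@(_ , inconsistent) = consistent (inconsistent r∈S (τ-empty AD cond)
    (λ rhs∈ → let (_ , r′∈τ , _) = ∈-map⁻ rhs rhs∈ in τ-empty AD cond r′∈τ))
  go SR cond@(_ , inconsistent) = consistent (inconsistent (τ≡[] τ (τ-empty SR cond)) r∈S)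
    where
    τ≡[] : ∀ τ → (∀ {r} → r ∉ τ) → τ ≡ []
    τ≡[] [] _ = refl
    τ≡[] (_ ∷ _) ∉τ = ⊥-elim (∉τ (here refl))

uniqueRhs⇒¬CondAD : ∀ S Kξ τ → τ ⊆ S → ∀ {r} → r ∈ S → Consistent (embed (K r) ++ Kξ) → ¬ Contained Kξ r →
  (∀ {r′} → r′ ∈ S → rhs r′ ≡ rhs r → r′ ≡ r) → ¬ Cond AD S Kξ τ
uniqueRhs⇒¬CondAD S Kξ τ τ⊆S {r} r∈S consistent ¬contained unique (contained , inconsistent) =
  consistent (inconsistent r∈S r∉τ rhs∉)
  where
  r∉τ : r ∉ τ
  r∉τ r∈τ = ¬contained (contained r∈τ)
  rhs∉ : rhs r ∉ map rhs τ
  rhs∉ rhs∈ with ∈-map⁻ rhs rhs∈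
  ... | r′ , r′∈τ , rhs≡ with unique (τ⊆S r′∈τ) (sym rhs≡)
  ... | refl = r∉τ r′∈τ

CondAR⇒CondAD : ∀ {S Kξ τ} → Cond AR S Kξ τ → Cond AD S Kξ τ
CondAR⇒CondAD (contained , inconsistent) = contained , λ r∈S r∉τ _ → inconsistent r∈S r∉τ

agreeing⇒consistent : ∀ {r} → ValidRule r → ∀ {Kξ} → Consistent Kξ →
  (∀ {a v x} → (a , v) ∈ K r → (a , x) ∈ Kξ → x ≡ just v) → Consistent (embed (K r) ++ Kξ)
agreeing⇒consistent {r} valid {Kξ} consistent agree (a , v , w , av∈ , aw∈ , v≢w)
  with ∈-++⁻ (embed (K r)) av∈ | ∈-++⁻ (embed (K r)) aw∈
... | inj₁ av∈r | inj₁ aw∈r =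
  let (δ , v≡ , aδ∈) = ∈-embed⁻ {K r} av∈r ; (δ′ , w≡ , aδ′∈) = ∈-embed⁻ {K r} aw∈r in
  v≢w (trans v≡ (trans (cong just (ValidRule⇒functional {r} valid aδ∈ aδ′∈)) (sym w≡)))
... | inj₂ av∈Kξ | inj₂ aw∈Kξ = consistent (a , v , w , av∈Kξ , aw∈Kξ , v≢w)
... | inj₁ av∈r | inj₂ aw∈Kξ = let (δ , v≡ , aδ∈) = ∈-embed⁻ {K r} av∈r in v≢w (trans v≡ (sym (agree aδ∈ aw∈Kξ)))
... | inj₂ av∈Kξ | inj₁ aw∈r = let (δ , w≡ , aδ∈) = ∈-embed⁻ {K r} aw∈r in v≢w (trans (agree aδ∈ av∈Kξ) (sym w≡))

Answered : (ℕ → Maybe ℕ) → List XEqn → Set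
Answered answer = All (λ (a , x) → x ≡ answer a)

Answered-consistent : ∀ {answer Kξ} → Answered answer Kξ → Consistent Kξ
Answered-consistent answered (a , v , w , av∈ , aw∈ , v≢w) =
  v≢w (trans (All.lookup answered av∈) (sym (All.lookup answered aw∈)))

fixedAdversary : ∀ C S (answer : ℕ → Maybe ℕ) → (∀ {a} → a ∈ attrs S → Edge (kind C) S a (answer a)) → Adversary C S
fixedAdversary C S answer edge = record
  { answer = λ _ a → answer a
  ; Invariant = Answered answer
  ; invariant-[] = []
  ; step = λ p a∈ answered → edge a∈ , ++⁺ answered (refl ∷ [])
  ; consistent = Answered-consistent
  }

unanswered : ∀ {Kξ : List XEqn} {a x} → a ∉ map proj₁ Kξ → (a , x) ∉ Kξ
unanswered a∉ ax∈ = a∉ (∈-map⁺ proj₁ ax∈)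

record Parameters (S : List Rule) (n d k : ℕ) : Set where
  field
    attr<n : ∀ {r a v} → r ∈ S → (a , v) ∈ K r → a < n
    attr-covered : ∀ {a} → a < n → Σ Rule λ r → r ∈ S × Σ ℕ λ v → (a , v) ∈ K r
    value<k : ∀ {r a v} → r ∈ S → (a , v) ∈ K r → v < k
    value-covered-at-0 : ∀ {v} → v < k → Σ Rule λ r → r ∈ S × (0 , v) ∈ K r
    len≤d : ∀ {r} → r ∈ S → len r ≤ d
    long-rule : Σ Rule λ r → r ∈ S × d ≤ len r
    0<k : 0 < k

  nS≡ : nS S ≡ n
  nS≡ = ≤-antisym
    (length≤-if-bounded (attrs-unique S) λ a∈ → let (r , r∈S , _ , av∈r) = ∈-attrs⁻ {S} a∈ in attr<n r∈S av∈r)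
    (length≥-if-covering λ a<n → let (r , r∈S , _ , av∈r) = attr-covered a<n in ∈-attrs⁺ {S} r∈S av∈r)

  dS≡ : dS S ≡ d
  dS≡ = maxList-≡ (map len S)
    (λ l∈ → let (r , r∈S , l≡) = ∈-map⁻ len l∈ in subst (_≤ d) (sym l≡) (len≤d r∈S))
    (let (r , r∈S , d≤) = long-rule in len r , ∈-map⁺ len r∈S , d≤)

  kS≡ : kS S ≡ k
  kS≡ = maxList-≡ (map (λ a → length (vals S a)) (attrs S))
    (λ l∈ → let (a , _ , l≡) = ∈-map⁻ (λ a → length (vals S a)) l∈ in
      subst (_≤ k) (sym l≡) (length≤-if-bounded (vals-unique S a)
        λ v∈ → let (r , r∈S , av∈r) = ∈-vals⁻ {S} v∈ in value<k r∈S av∈r))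
    (length (vals S 0) , ∈-map⁺ (λ a → length (vals S a)) 0∈attrs ,
     length≥-if-covering λ v<k → let (r , r∈S , 0v∈r) = value-covered-at-0 v<k in ∈-vals⁺ {S} r∈S 0v∈r)
    where
    0∈attrs : 0 ∈ attrs S
    0∈attrs = let (r , r∈S , 00∈r) = value-covered-at-0 0<k in ∈-attrs⁺ {S} r∈S 00∈r

∈-applyUpTo-elim : ∀ {A : Set} {P : A → Set} (f : ℕ → A) {n x} → (∀ {t} → t < n → P (f t)) →
  x ∈ applyUpTo f n → P x
∈-applyUpTo-elim f P-f x∈ with ∈-applyUpTo⁻ f x∈
... | _ , t< , refl = P-f t<

determined⇒SR-reduced : ∀ {S} → (∀ {r r′} → r ∈ S → r′ ∈ S → K r′ ⊆ K r → r′ ≡ r) → SR-reduced S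
determined⇒SR-reduced determined r∈S r′∈S (K⊆ , K⊉) with determined r∈S r′∈S K⊆
... | refl = K⊉ (λ ε∈ → ε∈)

SR-reduced⇒AD-reduced : ∀ {S} → SR-reduced S → AD-reduced S
SR-reduced⇒AD-reduced reduced r∈S r′∈S _ = reduced r∈S r′∈S

zeroBlock : ℕ → ℕ → List Eqn → List Eqn
zeroBlock s zero tl = tl
zeroBlock s (suc c) tl = (s , 0) ∷ zeroBlock (suc s) c tl

zeroBlock⁻ : ∀ s c tl {a v} → (a , v) ∈ zeroBlock s c tl → (s ≤ a × a < s + c × v ≡ 0) ⊎ (a , v) ∈ tl
zeroBlock⁻ s zero tl av∈ = inj₂ av∈
zeroBlock⁻ s (suc c) tl (here refl) = inj₁ (≤-refl , m<m+n s z<s , refl)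
zeroBlock⁻ s (suc c) tl (there av∈) with zeroBlock⁻ (suc s) c tl av∈
... | inj₁ (1+s≤a , a<1+s+c , v≡0) = inj₁ (<⇒≤ 1+s≤a , subst (_<_ _) (sym (+-suc s c)) a<1+s+c , v≡0)
... | inj₂ av∈tl = inj₂ av∈tl

zeroBlock⁺ : ∀ s c tl {a} → s ≤ a → a < s + c → (a , 0) ∈ zeroBlock s c tl
zeroBlock⁺ s zero tl s≤a a<s+0 = ⊥-elim (<-irrefl refl (<-≤-trans (subst (_ <_) (+-identityʳ s) a<s+0) s≤a))
zeroBlock⁺ s (suc c) tl {a} s≤a a<s+1+c with s ≟ a
... | yes refl = here refl
... | no s≢a = there (zeroBlock⁺ (suc s) c tl (≤∧≢⇒< s≤a s≢a) (subst (a <_) (+-suc s c) a<s+1+c))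

zeroBlock-tail : ∀ s c tl {ε} → ε ∈ tl → ε ∈ zeroBlock s c tl
zeroBlock-tail s zero tl ε∈ = ε∈
zeroBlock-tail s (suc c) tl ε∈ = there (zeroBlock-tail (suc s) c tl ε∈)

length-zeroBlock : ∀ s c tl → length (zeroBlock s c tl) ≡ c + length tl
length-zeroBlock s zero tl = refl
length-zeroBlock s (suc c) tl = cong suc (length-zeroBlock (suc s) c tl)

zeroBlock-linked : ∀ {x} s c tl → x < s → (∀ {y} → y < s + c → Linked _<_ (y ∷ map proj₁ tl)) →
  Linked _<_ (x ∷ map proj₁ (zeroBlock s c tl))
zeroBlock-linked s zero tl x<s tl-linked = tl-linked (subst (_ <_) (sym (+-identityʳ s)) x<s)
zeroBlock-linked s (suc c) tl x<s tl-linked =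
  x<s ∷ zeroBlock-linked (suc s) c tl ≤-refl (λ {y} y< → tl-linked (subst (y <_) (sym (+-suc s c)) y<))

-- For k ≥ 2 and d ≥ 2.  Answering a₀ = 0 and every other attribute 1 realizes no rule, while
-- Q t stays consistent as long as a_{t+1} is unanswered and U 0 as long as a₀ is; so every
-- attribute must be queried, whatever the problem.
module PairSystem (nn kk dd : ℕ) (d≤n : suc dd ≤ nn) where

  Q U R : ℕ → Rule
  Q t = ((0 , 0) ∷ (suc t , 0) ∷ []) , 0
  U t = ((0 , 1) ∷ (suc t , 1) ∷ []) , 0
  R t = ((0 , suc (suc t)) ∷ (1 , 1) ∷ []) , 0

  L : Rule
  L = ((0 , 1) ∷ zeroBlock 1 (suc dd) []) , 0

  S : List Rule
  S = applyUpTo Q nn ++ applyUpTo U nn ++ applyUpTo R kk ++ [ L ]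

  data Member : Rule → Set where
    isQ : ∀ t → t < nn → Member (Q t)
    isU : ∀ t → t < nn → Member (U t)
    isR : ∀ t → t < kk → Member (R t)
    isL : Member L

  member : ∀ {r} → r ∈ S → Member r
  member r∈ with ∈-++⁻ (applyUpTo Q nn) r∈
  ... | inj₁ r∈Q = ∈-applyUpTo-elim {P = Member} Q (isQ _) r∈Q
  ... | inj₂ r∈ with ∈-++⁻ (applyUpTo U nn) r∈
  ...   | inj₁ r∈U = ∈-applyUpTo-elim {P = Member} U (isU _) r∈U
  ...   | inj₂ r∈ with ∈-++⁻ (applyUpTo R kk) r∈
  ...     | inj₁ r∈R = ∈-applyUpTo-elim {P = Member} R (isR _) r∈R
  ...     | inj₂ (here refl) = isL

  Q∈ : ∀ {t} → t < nn → Q t ∈ S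
  Q∈ t< = ∈-++⁺ˡ (∈-applyUpTo⁺ Q t<)

  U∈ : ∀ {t} → t < nn → U t ∈ S
  U∈ t< = ∈-++⁺ʳ (applyUpTo Q nn) (∈-++⁺ˡ (∈-applyUpTo⁺ U t<))

  R∈ : ∀ {t} → t < kk → R t ∈ S
  R∈ t< = ∈-++⁺ʳ (applyUpTo Q nn) (∈-++⁺ʳ (applyUpTo U nn) (∈-++⁺ˡ (∈-applyUpTo⁺ R t<)))

  L∈ : L ∈ S
  L∈ = ∈-++⁺ʳ (applyUpTo Q nn) (∈-++⁺ʳ (applyUpTo U nn) (∈-++⁺ʳ (applyUpTo R kk) (here refl)))

  0<nn : 0 < nn
  0<nn = ≤-trans (s≤s z≤n) d≤n

  valid : ∀ {r} → Member r → ValidRule r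
  valid (isQ _ _) = z<s ∷ [-]
  valid (isU _ _) = z<s ∷ [-]
  valid (isR _ _) = z<s ∷ [-]
  valid isL = zeroBlock-linked 1 (suc dd) [] z<s (λ _ → [-])

  isSystem : IsSystem S
  isSystem = (λ S≡[] → ¬Any[] (subst (L ∈_) S≡[] L∈)) , All.tabulate (λ r∈ → valid (member r∈))

  ∈L⁻ : ∀ {a v} → (a , v) ∈ K L → (a ≡ 0 × v ≡ 1) ⊎ (1 ≤ a × a < suc (suc dd) × v ≡ 0)
  ∈L⁻ (here refl) = inj₁ (refl , refl)
  ∈L⁻ (there av∈) with zeroBlock⁻ 1 (suc dd) [] av∈
  ... | inj₁ inBlock = inj₂ inBlock

  determined : ∀ {r r′} → Member r → Member r′ → K r′ ⊆ K r → r′ ≡ r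
  determined (isQ _ _) (isQ _ _) K⊆ with K⊆ (there (here refl))
  ... | there (here refl) = refl
  determined (isU _ _) (isQ _ _) K⊆ with K⊆ (here refl)
  ... | there (here ())
  determined (isR _ _) (isQ _ _) K⊆ with K⊆ (here refl)
  ... | there (here ())
  determined isL (isQ _ _) K⊆ with ∈L⁻ (K⊆ (here refl))
  ... | inj₂ (() , _)
  determined (isQ _ _) (isU _ _) K⊆ with K⊆ (here refl)
  ... | there (here ())
  determined (isU _ _) (isU _ _) K⊆ with K⊆ (there (here refl))
  ... | there (here refl) = refl
  determined (isR _ _) (isU _ _) K⊆ with K⊆ (here refl)
  ... | there (here ())
  determined isL (isU _ _) K⊆ with ∈L⁻ (K⊆ (there (here refl)))
  ... | inj₁ (() , _)
  determined (isQ _ _) (isR _ _) K⊆ with K⊆ (here refl)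
  ... | there (here ())
  determined (isU _ _) (isR _ _) K⊆ with K⊆ (here refl)
  ... | there (here ())
  determined (isR _ _) (isR _ _) K⊆ with K⊆ (here refl)
  ... | here refl = refl
  ... | there (here ())
  determined isL (isR _ _) K⊆ with ∈L⁻ (K⊆ (here refl))
  ... | inj₂ (() , _)
  determined (isQ _ _) isL K⊆ with K⊆ (here refl)
  ... | there (here ())
  determined (isU _ _) isL K⊆ with K⊆ (there (here refl))
  ... | there (here ())
  determined (isR _ _) isL K⊆ with K⊆ (there (here refl))
  ... | here ()
  ... | there (here ())
  determined isL isL _ = refl

  reduced : SR-reduced S
  reduced = determined⇒SR-reduced λ r∈ r′∈ → determined (member r∈) (member r′∈)

  bounds : ∀ {r a v} → Member r → (a , v) ∈ K r → a < suc nn × v < suc (suc kk)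
  bounds (isQ _ _) (here refl) = z<s , z<s
  bounds (isQ _ t<) (there (here refl)) = s≤s t< , z<s
  bounds (isU _ _) (here refl) = z<s , s≤s z<s
  bounds (isU _ t<) (there (here refl)) = s≤s t< , s≤s z<s
  bounds (isR _ t<) (here refl) = z<s , s≤s (s≤s t<)
  bounds (isR _ _) (there (here refl)) = s≤s 0<nn , s≤s z<s
  bounds isL av∈ with ∈L⁻ av∈
  ... | inj₁ (refl , refl) = z<s , s≤s z<s
  ... | inj₂ (_ , a<2+dd , refl) = ≤-trans a<2+dd (s≤s d≤n) , z<s

  length-L : len L ≡ suc (suc dd)
  length-L = cong suc (trans (length-zeroBlock 1 (suc dd) []) (+-identityʳ (suc dd)))

  len≤ : ∀ {r} → Member r → len r ≤ suc (suc dd)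
  len≤ (isQ _ _) = s≤s (s≤s z≤n)
  len≤ (isU _ _) = s≤s (s≤s z≤n)
  len≤ (isR _ _) = s≤s (s≤s z≤n)
  len≤ isL = ≤-reflexive length-L

  parameters : Parameters S (suc nn) (suc (suc dd)) (suc (suc kk))
  parameters = record
    { attr<n = λ r∈ av∈ → proj₁ (bounds (member r∈) av∈)
    ; attr-covered = λ { {zero} _ → L , L∈ , 1 , here refl
                       ; {suc t} (s≤s t<) → Q t , Q∈ t< , 0 , there (here refl) }
    ; value<k = λ r∈ av∈ → proj₂ (bounds (member r∈) av∈)
    ; value-covered-at-0 = λ { {zero} _ → Q 0 , Q∈ 0<nn , here refl
                             ; {suc zero} _ → L , L∈ , here refl
                             ; {suc (suc t)} (s≤s (s≤s t<)) → R t , R∈ t< , here refl }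
    ; len≤d = λ r∈ → len≤ (member r∈)
    ; long-rule = L , L∈ , ≤-reflexive (sym length-L)
    ; 0<k = z<s
    }

  answer : ℕ → Maybe ℕ
  answer zero = just 0
  answer (suc _) = just 1

  answer-edge : ∀ κ {a} → a ∈ attrs S → Edge κ S a (answer a)
  answer-edge κ {zero} _ = value-edge κ (∈-vals⁺ {S} (Q∈ 0<nn) (here refl))
  answer-edge κ {suc t} a∈ with ∈-attrs⁻ {S} a∈
  ... | r , r∈ , _ , av∈r with bounds (member r∈) av∈r
  ...   | s≤s t< , _ = value-edge κ (∈-vals⁺ {S} (U∈ t<) (there (here refl)))

  unanswered⇒¬Cond : ∀ P Kξ → Answered answer Kξ → ∀ {a} → a ∈ attrs S → a ∉ map proj₁ Kξ →
    ∀ τ → τ ⊆ S → ¬ Cond P S Kξ τ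
  unanswered⇒¬Cond P Kξ answered {a} a∈ a∉ τ τ⊆S =
    noneContained⇒¬Cond P S Kξ τ τ⊆S (λ r∈ → not-realized (member r∈)) (still-consistent a a∈ a∉)
    where
    wrong-answer : ∀ {b v} → (b , just v) ∈ Kξ → answer b ≢ just v → ⊥
    wrong-answer bv∈ ≢ = ≢ (sym (All.lookup answered bv∈))
    not-realized : ∀ {r} → Member r → ¬ Contained Kξ r
    not-realized (isQ _ _) contained = wrong-answer (contained (there (here refl))) (λ ())
    not-realized (isU _ _) contained = wrong-answer (contained (here refl)) (λ ())
    not-realized (isR _ _) contained = wrong-answer (contained (here refl)) (λ ())
    not-realized isL contained = wrong-answer (contained (here refl)) (λ ())
    still-consistent : ∀ a → a ∈ attrs S → a ∉ map proj₁ Kξ → Σ Rule λ r → r ∈ S × Consistent (embed (K r) ++ Kξ)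
    still-consistent zero _ a∉ =
      U 0 , U∈ 0<nn , agreeing⇒consistent {U 0} (valid (isU 0 0<nn)) (Answered-consistent {answer} answered) agree
      where
      agree : ∀ {b v x} → (b , v) ∈ K (U 0) → (b , x) ∈ Kξ → x ≡ just v
      agree (here refl) bx∈ = ⊥-elim (unanswered a∉ bx∈)
      agree (there (here refl)) bx∈ = All.lookup answered bx∈
    still-consistent (suc t) a∈ a∉ with ∈-attrs⁻ {S} a∈
    ... | r , r∈ , _ , av∈r with bounds (member r∈) av∈r
    ...   | s≤s t< , _ =
      Q t , Q∈ t< , agreeing⇒consistent {Q t} (valid (isQ t t<)) (Answered-consistent {answer} answered) agree
      where
      agree : ∀ {b v x} → (b , v) ∈ K (Q t) → (b , x) ∈ Kξ → x ≡ just v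
      agree (here refl) bx∈ = All.lookup answered bx∈
      agree (there (here refl)) bx∈ = ⊥-elim (unanswered a∉ bx∈)

  hC≡n : ∀ C → hC C S (suc nn)
  hC≡n C = hC≡nS C S nS≡ λ Γ h solves depth → subst (_≤ h) nS≡
    (adversary⇒nS≤depth (fixedAdversary C S answer (answer-edge (kind C)))
      (λ Kξ answered → unanswered⇒¬Cond (prob C) Kξ answered) Γ h solves depth)
    where open Parameters parameters using (nS≡)

zeroBlock-then-linked : ∀ c y → c ≤ y → Linked _<_ (map proj₁ (zeroBlock 0 c [ (y , 0) ]))
zeroBlock-then-linked zero y _ = [-]
zeroBlock-then-linked (suc c) y c<y = zeroBlock-linked 1 c _ z<s (λ y′<1+c → ≤-trans y′<1+c c<y ∷ [-])

-- Answering 0 everywhere, a petal is realized only once all its c + 1 attributes are queried.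
-- Its right-hand side being unique, an AD-tree may drop it only once it is realized, which needs
-- its petal attribute; hence every attribute is queried.
module Sunflower (c m kk : ℕ) where

  Petal : ℕ → Rule
  Petal t = zeroBlock 0 c [ (c + t , 0) ] , t

  T : ℕ → Rule
  T j = [ (0 , suc j) ] , suc m

  S : List Rule
  S = applyUpTo Petal (suc m) ++ applyUpTo T kk

  data Member : Rule → Set where
    isPetal : ∀ t → t < suc m → Member (Petal t)
    isT : ∀ j → j < kk → Member (T j)

  member : ∀ {r} → r ∈ S → Member r
  member r∈ with ∈-++⁻ (applyUpTo Petal (suc m)) r∈
  ... | inj₁ r∈P = ∈-applyUpTo-elim {P = Member} Petal (isPetal _) r∈P
  ... | inj₂ r∈T = ∈-applyUpTo-elim {P = Member} T (isT _) r∈T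

  Petal∈ : ∀ {t} → t < suc m → Petal t ∈ S
  Petal∈ t< = ∈-++⁺ˡ (∈-applyUpTo⁺ Petal t<)

  T∈ : ∀ {j} → j < kk → T j ∈ S
  T∈ j< = ∈-++⁺ʳ (applyUpTo Petal (suc m)) (∈-applyUpTo⁺ T j<)

  valid : ∀ {r} → Member r → ValidRule r
  valid (isPetal t _) = zeroBlock-then-linked c (c + t) (m≤m+n c t)
  valid (isT _ _) = [-]

  isSystem : IsSystem S
  isSystem = (λ S≡[] → ¬Any[] (subst (Petal 0 ∈_) S≡[] (Petal∈ z<s))) , All.tabulate (λ r∈ → valid (member r∈))

  ∈Petal⁻ : ∀ t {a v} → (a , v) ∈ K (Petal t) → v ≡ 0 × (a < c ⊎ a ≡ c + t)
  ∈Petal⁻ t av∈ with zeroBlock⁻ 0 c _ av∈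
  ... | inj₁ (_ , a<c , v≡0) = v≡0 , inj₁ a<c
  ... | inj₂ (here refl) = refl , inj₂ refl

  petal-attr : ∀ t → (c + t , 0) ∈ K (Petal t)
  petal-attr t = zeroBlock-tail 0 c _ (here refl)

  core-attr : ∀ t {a} → a < c → (a , 0) ∈ K (Petal t)
  core-attr t a<c = zeroBlock⁺ 0 c _ z≤n a<c

  covered : ∀ {a} → a < c + suc m → Σ ℕ λ t → t < suc m × (a , 0) ∈ K (Petal t)
  covered {a} a< with a <? c
  ... | yes a<c = 0 , z<s , core-attr 0 a<c
  ... | no a≮c = a ∸ c , +-cancelˡ-< c (a ∸ c) (suc m) (subst (_< c + suc m) (sym c+[a∸c]≡a) a<) ,
                 subst (λ b → (b , 0) ∈ K (Petal (a ∸ c))) c+[a∸c]≡a (petal-attr (a ∸ c))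
    where
    c+[a∸c]≡a : c + (a ∸ c) ≡ a
    c+[a∸c]≡a = m+[n∸m]≡n (≮⇒≥ a≮c)

  determined : ∀ {r r′} → Member r → Member r′ → K r′ ⊆ K r → r′ ≡ r
  determined (isPetal t′ _) (isPetal t _) K⊆ with ∈Petal⁻ t′ (K⊆ (petal-attr t))
  ... | _ , inj₁ c+t<c = ⊥-elim (<-irrefl refl (≤-<-trans (m≤m+n c t) c+t<c))
  ... | _ , inj₂ c+t≡c+t′ = cong Petal (sym (+-cancelˡ-≡ c t′ t (sym c+t≡c+t′)))
  determined (isT _ _) (isPetal t _) K⊆ with K⊆ (petal-attr t)
  ... | here ()
  determined (isPetal t _) (isT _ _) K⊆ with ∈Petal⁻ t (K⊆ (here refl))
  ... | () , _
  determined (isT _ _) (isT _ _) K⊆ with K⊆ (here refl)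
  ... | here refl = refl

  reduced : SR-reduced S
  reduced = determined⇒SR-reduced λ r∈ r′∈ → determined (member r∈) (member r′∈)

  length-Petal : ∀ t → len (Petal t) ≡ suc c
  length-Petal t = trans (length-zeroBlock 0 c _) (+-comm c 1)

  bounds : ∀ {r a v} → Member r → (a , v) ∈ K r → a < c + suc m × v < suc kk
  bounds (isPetal t t<) av∈ with ∈Petal⁻ t av∈
  ... | refl , inj₁ a<c = <-≤-trans a<c (m≤m+n c (suc m)) , z<s
  ... | refl , inj₂ refl = +-monoʳ-< c t< , z<s
  bounds (isT _ j<) (here refl) = <-≤-trans z<s (m≤n+m (suc m) c) , s≤s j<

  parameters : Parameters S (c + suc m) (suc c) (suc kk)
  parameters = record
    { attr<n = λ r∈ av∈ → proj₁ (bounds (member r∈) av∈)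
    ; attr-covered = λ a< → let (t , t< , a0∈) = covered a< in Petal t , Petal∈ t< , 0 , a0∈
    ; value<k = λ r∈ av∈ → proj₂ (bounds (member r∈) av∈)
    ; value-covered-at-0 = λ { {zero} _ → let (t , t< , 00∈) = covered (<-≤-trans z<s (m≤n+m (suc m) c)) in
                                          Petal t , Petal∈ t< , 00∈
                             ; {suc j} (s≤s j<) → T j , T∈ j< , here refl }
    ; len≤d = λ r∈ → len≤ (member r∈)
    ; long-rule = Petal 0 , Petal∈ z<s , ≤-reflexive (sym (length-Petal 0))
    ; 0<k = z<s
    }
    where
    len≤ : ∀ {r} → Member r → len r ≤ suc c
    len≤ (isPetal t _) = ≤-reflexive (length-Petal t)
    len≤ (isT _ _) = s≤s z≤n

  open Parameters parameters using (nS≡)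

  attrs< : ∀ {a} → a ∈ attrs S → a < c + suc m
  attrs< a∈ = let (r , r∈ , _ , av∈r) = ∈-attrs⁻ {S} a∈ in proj₁ (bounds (member r∈) av∈r)

  answer : ℕ → Maybe ℕ
  answer _ = just 0

  answer-edge : ∀ κ {a} → a ∈ attrs S → Edge κ S a (answer a)
  answer-edge κ a∈ = let (t , t< , a0∈) = covered (attrs< a∈) in value-edge κ (∈-vals⁺ {S} (Petal∈ t<) a0∈)

  adversary : ∀ C → Adversary C S
  adversary C = fixedAdversary C S answer (answer-edge (kind C))

  petal-consistent : ∀ Kξ → Answered answer Kξ → ∀ {t} → t < suc m → Consistent (embed (K (Petal t)) ++ Kξ)
  petal-consistent Kξ answered {t} t< =
    agreeing⇒consistent {Petal t} (valid (isPetal t t<)) (Answered-consistent {answer} answered) agree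
    where
    agree : ∀ {b v x} → (b , v) ∈ K (Petal t) → (b , x) ∈ Kξ → x ≡ just v
    agree bv∈ bx∈ with ∈Petal⁻ t bv∈
    ... | refl , _ = All.lookup answered bx∈

  unanswered⇒¬CondAD : ∀ Kξ → Answered answer Kξ → ∀ {a} → a ∈ attrs S → a ∉ map proj₁ Kξ →
    ∀ τ → τ ⊆ S → ¬ Cond AD S Kξ τ
  unanswered⇒¬CondAD Kξ answered {a} a∈ a∉ τ τ⊆S with covered (attrs< a∈)
  ... | t , t< , a0∈ = uniqueRhs⇒¬CondAD S Kξ τ τ⊆S (Petal∈ t<) (petal-consistent Kξ answered t<)
                         (λ contained → unanswered a∉ (contained (∈-embed⁺ {K (Petal t)} a0∈))) unique
    where
    unique : ∀ {r′} → r′ ∈ S → rhs r′ ≡ t → r′ ≡ Petal t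
    unique r′∈ with member r′∈
    ... | isPetal _ _ = λ { refl → refl }
    ... | isT _ _ = λ { refl → ⊥-elim (<-irrefl refl t<) }

  n≤depth : ∀ C → (∀ {Kξ τ} → Cond (prob C) S Kξ τ → Cond AD S Kξ τ) →
    ∀ Γ h → Solves C S Γ → Depth (kind C) S Γ h → nS S ≤ h
  n≤depth C toAD = adversary⇒nS≤depth (adversary C)
    λ Kξ answered a∈ a∉ τ τ⊆S cond → unanswered⇒¬CondAD Kξ answered a∈ a∉ τ τ⊆S (toAD cond)

  hC≡n : ∀ C → (∀ {Kξ τ} → Cond (prob C) S Kξ τ → Cond AD S Kξ τ) → hC C S (c + suc m)
  hC≡n C toAD = hC≡nS C S nS≡ (λ Γ h solves depth → subst (_≤ h) nS≡ (n≤depth C toAD Γ h solves depth))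

  d≤depth-SR : ∀ Γ h → Solves SRc S Γ → Depth o S Γ h → suc c ≤ h
  d≤depth-SR = adversary-lower-bound (adversary SRc) (suc c) long
    where
    long : ∀ Kξ τ → Answered answer Kξ → τ ⊆ S → Cond SR S Kξ τ → suc c ≤ length Kξ
    long Kξ [] answered _ (_ , inconsistent) = ⊥-elim (petal-consistent Kξ answered z<s (inconsistent refl (Petal∈ z<s)))
    long Kξ (r ∷ _) answered τ⊆S (contained , _) = realized-long (member (τ⊆S (here refl))) (contained (here refl))
      where
      realized-long : ∀ {r} → Member r → Contained Kξ r → suc c ≤ length Kξ
      realized-long (isT _ _) contained with All.lookup answered (contained (here refl))
      ... | ()
      realized-long (isPetal t t<) contained = begin
        suc c                          ≡⟨ sym (length-Petal t) ⟩
        len (Petal t)                  ≡⟨ sym (length-map proj₁ (K (Petal t))) ⟩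
        length (map proj₁ (K (Petal t))) ≤⟨ Unique⇒length≤ (Linked<⇒Unique (valid (isPetal t t<))) keys⊆ ⟩
        length (map proj₁ Kξ)          ≡⟨ length-map proj₁ Kξ ⟩
        length Kξ                      ∎
        where
        open ≤-Reasoning
        keys⊆ : map proj₁ (K (Petal t)) ⊆ map proj₁ Kξ
        keys⊆ a∈ with ∈-map⁻ proj₁ a∈
        ... | _ , av∈ , refl = ∈-map⁺ proj₁ (contained (∈-embed⁺ {K (Petal t)} av∈))

  hSR≡d : (Σ ℕ λ h → hC SRc S h × h ≤ suc c) → hC SRc S (suc c)
  hSR≡d upper = hC-exact SRc S (suc c) upper d≤depth-SR

  n≤depth-ESR-without-core : c ≡ 0 → ∀ Γ h → Solves ESRc S Γ → Depth e S Γ h → nS S ≤ h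
  n≤depth-ESR-without-core refl =
    adversary⇒nS≤depth (fixedAdversary ESRc S (λ _ → nothing) (λ _ → inj₁ refl)) unanswered⇒¬Cond
    where
    unanswered⇒¬Cond : ∀ Kξ → Answered (λ _ → nothing) Kξ → ∀ {a} → a ∈ attrs S → a ∉ map proj₁ Kξ →
      ∀ τ → τ ⊆ S → ¬ Cond SR S Kξ τ
    unanswered⇒¬Cond Kξ answered {a} a∈ a∉ τ τ⊆S with covered (attrs< a∈)
    ... | t , t< , a0∈ with ∈Petal⁻ t a0∈
    ...   | _ , inj₂ refl = noneContained⇒¬Cond SR S Kξ τ τ⊆S (λ r∈ → not-realized (member r∈))
      (Petal t , Petal∈ t< ,
       agreeing⇒consistent {Petal t} (valid (isPetal t t<)) (Answered-consistent {λ _ → nothing} answered) agree)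
      where
      not-realized : ∀ {r} → Member r → ¬ Contained Kξ r
      not-realized (isPetal t _) contained with All.lookup answered (contained (here refl))
      ... | ()
      not-realized (isT _ _) contained with All.lookup answered (contained (here refl))
      ... | ()
      agree : ∀ {b v x} → (b , v) ∈ K (Petal t) → (b , x) ∈ Kξ → x ≡ just v
      agree (here refl) bx∈ = ⊥-elim (unanswered a∉ bx∈)

  hESR≡n-without-core : c ≡ 0 → hC ESRc S (c + suc m)
  hESR≡n-without-core c≡0 = hC≡nS ESRc S nS≡ λ Γ h solves depth →
    subst (_≤ h) nS≡ (n≤depth-ESR-without-core c≡0 Γ h solves depth)

lookupAnswer : List XEqn → ℕ → Maybe (Maybe ℕ)
lookupAnswer [] a = nothing
lookupAnswer ((b , x) ∷ p) a with b ≟ a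
... | yes _ = just x
... | no _ = lookupAnswer p a

lookupAnswer-just : ∀ p a {x} → lookupAnswer p a ≡ just x → (a , x) ∈ p
lookupAnswer-just ((b , y) ∷ p) a eq with b ≟ a
lookupAnswer-just ((b , y) ∷ p) a refl | yes refl = here refl
... | no _ = there (lookupAnswer-just p a eq)

lookupAnswer-nothing : ∀ p a → lookupAnswer p a ≡ nothing → a ∉ map proj₁ p
lookupAnswer-nothing ((b , y) ∷ p) a eq a∈ with b ≟ a
lookupAnswer-nothing ((b , y) ∷ p) a () a∈ | yes _
lookupAnswer-nothing ((b , y) ∷ p) a eq (here refl) | no b≢a = b≢a refl
lookupAnswer-nothing ((b , y) ∷ p) a eq (there a∈) | no _ = lookupAnswer-nothing p a eq a∈

fresh-extension-consistent : ∀ {p a} x → Consistent p → a ∉ map proj₁ p → Consistent (p ++ [ (a , x) ])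
fresh-extension-consistent {p} x consistent a∉ (b , v , w , bv∈ , bw∈ , v≢w) with ∈-++⁻ p bv∈ | ∈-++⁻ p bw∈
... | inj₁ bv∈p | inj₁ bw∈p = consistent (b , v , w , bv∈p , bw∈p , v≢w)
... | inj₁ bv∈p | inj₂ (here refl) = unanswered a∉ bv∈p
... | inj₂ (here refl) | inj₁ bw∈p = unanswered a∉ bw∈p
... | inj₂ (here refl) | inj₂ (here refl) = v≢w refl

map-proj₁-++⁺ˡ : ∀ {p : List XEqn} {y b} → b ∈ map proj₁ p → b ∈ map proj₁ (p ++ [ y ])
map-proj₁-++⁺ˡ b∈ with ∈-map⁻ proj₁ b∈
... | _ , ε∈ , refl = ∈-map⁺ proj₁ (∈-++⁺ˡ ε∈)

-- The adversary answers ∗ outside the block, and 0 on a block attribute unless it is the last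
-- unanswered one, which gets ∗: the block stays consistent but unrealized until all of it is
-- queried, and a singleton stays consistent until its attribute is queried.
module BlockAndSingletons (D′ m : ℕ) where

  D : ℕ
  D = suc D′

  Block : Rule
  Block = zeroBlock 0 D [] , 0

  Single : ℕ → Rule
  Single t = [ (D + t , 0) ] , 0

  S : List Rule
  S = Block ∷ applyUpTo Single m

  data Member : Rule → Set where
    isBlock : Member Block
    isSingle : ∀ t → t < m → Member (Single t)

  member : ∀ {r} → r ∈ S → Member r
  member (here refl) = isBlock
  member (there r∈) = ∈-applyUpTo-elim {P = Member} Single (isSingle _) r∈

  Single∈ : ∀ {t} → t < m → Single t ∈ S
  Single∈ t< = there (∈-applyUpTo⁺ Single t<)

  valid : ∀ {r} → Member r → ValidRule r
  valid isBlock = zeroBlock-linked 1 D′ [] z<s (λ _ → [-])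
  valid (isSingle _ _) = [-]

  isSystem : IsSystem S
  isSystem = (λ ()) , All.tabulate (λ r∈ → valid (member r∈))

  ∈Block⁻ : ∀ {a v} → (a , v) ∈ K Block → a < D × v ≡ 0
  ∈Block⁻ av∈ with zeroBlock⁻ 0 D [] av∈
  ... | inj₁ (_ , a<D , v≡0) = a<D , v≡0

  ∈Block⁺ : ∀ {a} → a < D → (a , 0) ∈ K Block
  ∈Block⁺ a<D = zeroBlock⁺ 0 D [] z≤n a<D

  determined : ∀ {r r′} → Member r → Member r′ → K r′ ⊆ K r → r′ ≡ r
  determined isBlock isBlock _ = refl
  determined isBlock (isSingle t _) K⊆ = ⊥-elim (<-irrefl refl (≤-<-trans (m≤m+n D t) (proj₁ (∈Block⁻ (K⊆ (here refl))))))
  determined (isSingle _ _) isBlock K⊆ with K⊆ (∈Block⁺ z<s)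
  ... | here ()
  determined (isSingle t′ _) (isSingle t _) K⊆ with K⊆ (here refl)
  ... | here D+t≡D+t′ = cong Single (+-cancelˡ-≡ D t t′ (cong proj₁ D+t≡D+t′))

  reduced : SR-reduced S
  reduced = determined⇒SR-reduced λ r∈ r′∈ → determined (member r∈) (member r′∈)

  bounds : ∀ {r a v} → Member r → (a , v) ∈ K r → a < D + m × v ≡ 0
  bounds isBlock av∈ = let (a<D , v≡0) = ∈Block⁻ av∈ in <-≤-trans a<D (m≤m+n D m) , v≡0
  bounds (isSingle t t<) (here refl) = +-monoʳ-< D t< , refl

  length-Block : len Block ≡ D
  length-Block = trans (length-zeroBlock 0 D []) (+-identityʳ D)

  parameters : Parameters S (D + m) D 1
  parameters = record
    { attr<n = λ r∈ av∈ → proj₁ (bounds (member r∈) av∈)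
    ; attr-covered = covered
    ; value<k = λ r∈ av∈ → subst (_< 1) (sym (proj₂ (bounds (member r∈) av∈))) z<s
    ; value-covered-at-0 = λ { {zero} _ → Block , here refl , ∈Block⁺ z<s ; {suc _} (s≤s ()) }
    ; len≤d = λ r∈ → len≤ (member r∈)
    ; long-rule = Block , here refl , ≤-reflexive (sym length-Block)
    ; 0<k = z<s
    }
    where
    len≤ : ∀ {r} → Member r → len r ≤ D
    len≤ isBlock = ≤-reflexive length-Block
    len≤ (isSingle _ _) = s≤s z≤n
    covered : ∀ {a} → a < D + m → Σ Rule λ r → r ∈ S × Σ ℕ λ v → (a , v) ∈ K r
    covered {a} a< with a <? D
    ... | yes a<D = Block , here refl , 0 , ∈Block⁺ a<D
    ... | no a≮D = Single (a ∸ D) ,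
                   Single∈ (+-cancelˡ-< D (a ∸ D) m (subst (_< D + m) (sym (m+[n∸m]≡n (≮⇒≥ a≮D))) a<)) ,
                   0 , subst (λ b → (b , 0) ∈ K (Single (a ∸ D))) (m+[n∸m]≡n (≮⇒≥ a≮D)) (here refl)

  open Parameters parameters using (nS≡)

  OpenCore : List XEqn → ℕ → Set
  OpenCore p a = Σ ℕ λ b → b ∈ upTo D × b ≢ a × b ∉ map proj₁ p

  openCore? : ∀ p a → Dec (OpenCore p a)
  openCore? p a = any∈? (λ b → ¬? (b ≟ a) ×-dec ¬? (b ∈ℕ? map proj₁ p)) (upTo D)

  freshAnswer : ∀ {p a} → Dec (a < D) → Dec (OpenCore p a) → Maybe ℕ
  freshAnswer (yes _) (yes _) = just 0
  freshAnswer (yes _) (no _) = nothing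
  freshAnswer (no _) _ = nothing

  answer : List XEqn → ℕ → Maybe ℕ
  answer p a with lookupAnswer p a
  ... | just x = x
  ... | nothing = freshAnswer (a <? D) (openCore? p a)

  record Invariant (p : List XEqn) : Set where
    field
      consistent : Consistent p
      shape : ∀ {b x} → (b , x) ∈ p → x ≡ nothing ⊎ (x ≡ just 0 × b < D)
      star⇒core-answered : ∀ {b} → (b , nothing) ∈ p → b < D → ∀ {b′} → b′ < D → b′ ∈ map proj₁ p
      core-open : Σ ℕ λ b → b < D × (b , just 0) ∉ p

  invariant-[] : Invariant []
  invariant-[] = record
    { consistent = λ { (_ , _ , _ , () , _) }
    ; shape = λ ()
    ; star⇒core-answered = λ ()
    ; core-open = 0 , z<s , λ ()
    }

  invariant-repeat : ∀ {p a x} → Invariant p → (a , x) ∈ p → Invariant (p ++ [ (a , x) ])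
  invariant-repeat {p} {a} {x} inv ax∈ = record
    { consistent = λ (b , v , w , bv∈ , bw∈ , v≢w) → consistent (b , v , w , back bv∈ , back bw∈ , v≢w)
    ; shape = λ bx∈ → shape (back bx∈)
    ; star⇒core-answered = λ b∈ b<D b′<D → map-proj₁-++⁺ˡ (star⇒core-answered (back b∈) b<D b′<D)
    ; core-open = let (b , b<D , b∉) = core-open in b , b<D , λ b∈ → b∉ (back b∈)
    }
    where
    open Invariant inv
    back : p ++ [ (a , x) ] ⊆ p
    back ε∈ with ∈-++⁻ p ε∈
    ... | inj₁ ε∈p = ε∈p
    ... | inj₂ (here refl) = ax∈

  invariant-star : ∀ {p a} → Invariant p → a ∉ map proj₁ p → D ≤ a ⊎ ¬ OpenCore p a → Invariant (p ++ [ (a , nothing) ])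
  invariant-star {p} {a} inv a∉ last = record
    { consistent = fresh-extension-consistent nothing consistent a∉
    ; shape = λ bx∈ → [ shape , (λ { (here refl) → inj₁ refl }) ]′ (∈-++⁻ p bx∈)
    ; star⇒core-answered = star⇒core-answered′ last
    ; core-open = let (b , b<D , b∉) = core-open in b , b<D , λ b∈ → [ b∉ , (λ { (here ()) }) ]′ (∈-++⁻ p b∈)
    }
    where
    open Invariant inv
    star⇒core-answered′ : D ≤ a ⊎ ¬ OpenCore p a → ∀ {b} → (b , nothing) ∈ p ++ [ (a , nothing) ] → b < D →
      ∀ {b′} → b′ < D → b′ ∈ map proj₁ (p ++ [ (a , nothing) ])
    star⇒core-answered′ last b∈ b<D {b′} b′<D with ∈-++⁻ p b∈ | last
    ... | inj₁ b∈p | _ = map-proj₁-++⁺ˡ (star⇒core-answered b∈p b<D b′<D)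
    ... | inj₂ (here refl) | inj₁ D≤a = ⊥-elim (<-irrefl refl (<-≤-trans b<D D≤a))
    ... | inj₂ (here refl) | inj₂ closed with b′ ≟ a | b′ ∈ℕ? map proj₁ p
    ...   | yes refl | _ = ∈-map⁺ proj₁ (∈-++⁺ʳ p (here refl))
    ...   | no _ | yes b′∈ = map-proj₁-++⁺ˡ b′∈
    ...   | no b′≢a | no b′∉ = ⊥-elim (closed (b′ , ∈-upTo⁺ b′<D , b′≢a , b′∉))

  invariant-zero : ∀ {p a} → Invariant p → a ∉ map proj₁ p → a < D → OpenCore p a → Invariant (p ++ [ (a , just 0) ])
  invariant-zero {p} {a} inv a∉ a<D (b , b∈upTo , b≢a , b∉) = record
    { consistent = fresh-extension-consistent (just 0) consistent a∉
    ; shape = λ cx∈ → [ shape , (λ { (here refl) → inj₂ (refl , a<D) }) ]′ (∈-++⁻ p cx∈)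
    ; star⇒core-answered = λ c∈ c<D c′<D →
        [ (λ c∈p → map-proj₁-++⁺ˡ (star⇒core-answered c∈p c<D c′<D)) , (λ { (here ()) }) ]′ (∈-++⁻ p c∈)
    ; core-open = b , ∈-upTo⁻ b∈upTo , λ b0∈ → [ unanswered b∉ , (λ { (here refl) → b≢a refl }) ]′ (∈-++⁻ p b0∈)
    }
    where open Invariant inv

  core-edge : ∀ {a} → a < D → Edge e S a (just 0)
  core-edge {a} a<D = value-edge e {S} {a} (∈-vals⁺ {S} (here refl) (∈Block⁺ a<D))

  step : ∀ p {a} → a ∈ attrs S → Invariant p → Edge e S a (answer p a) × Invariant (p ++ [ (a , answer p a) ])
  step p {a} _ inv with lookupAnswer p a in lookup≡
  ... | just x = shape-edge (Invariant.shape inv ax∈) , invariant-repeat inv ax∈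
    where
    ax∈ : (a , x) ∈ p
    ax∈ = lookupAnswer-just p a lookup≡
    shape-edge : x ≡ nothing ⊎ (x ≡ just 0 × a < D) → Edge e S a x
    shape-edge (inj₁ refl) = inj₁ refl
    shape-edge (inj₂ (refl , a<D)) = core-edge a<D
  ... | nothing with a <? D | openCore? p a
  ...   | yes a<D | yes openCore = core-edge a<D , invariant-zero inv (lookupAnswer-nothing p a lookup≡) a<D openCore
  ...   | yes _ | no closed = inj₁ refl , invariant-star inv (lookupAnswer-nothing p a lookup≡) (inj₂ closed)
  ...   | no a≮D | _ = inj₁ refl , invariant-star inv (lookupAnswer-nothing p a lookup≡) (inj₁ (≮⇒≥ a≮D))

  adversary : Adversary ESRc S
  adversary = record
    { answer = answer
    ; Invariant = Invariant
    ; invariant-[] = invariant-[]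
    ; step = step
    ; consistent = Invariant.consistent
    }

  unanswered⇒¬Cond : ∀ Kξ → Invariant Kξ → ∀ {a} → a ∈ attrs S → a ∉ map proj₁ Kξ → ∀ τ → τ ⊆ S → ¬ Cond SR S Kξ τ
  unanswered⇒¬Cond Kξ inv {a} a∈ a∉ τ τ⊆S =
    noneContained⇒¬Cond SR S Kξ τ τ⊆S (λ r∈ → not-realized (member r∈)) still-consistent
    where
    open Invariant inv
    not-realized : ∀ {r} → Member r → ¬ Contained Kξ r
    not-realized isBlock contained = let (b , b<D , b∉) = core-open in b∉ (contained (∈-embed⁺ {K Block} (∈Block⁺ b<D)))
    not-realized (isSingle t _) contained with shape (contained (here refl))
    ... | inj₁ ()
    ... | inj₂ (_ , D+t<D) = <-irrefl refl (≤-<-trans (m≤m+n D t) D+t<D)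
    still-consistent : Σ Rule λ r → r ∈ S × Consistent (embed (K r) ++ Kξ)
    still-consistent with a <? D
    ... | yes a<D = Block , here refl , agreeing⇒consistent {Block} (valid isBlock) consistent agree
      where
      agree : ∀ {b v x} → (b , v) ∈ K Block → (b , x) ∈ Kξ → x ≡ just v
      agree bv∈ bx∈ with ∈Block⁻ bv∈ | shape bx∈
      ... | b<D , refl | inj₁ refl = ⊥-elim (a∉ (star⇒core-answered bx∈ b<D a<D))
      ... | _ , refl | inj₂ (refl , _) = refl
    ... | no a≮D = Single (a ∸ D) , Single∈ t< , agreeing⇒consistent {Single (a ∸ D)} [-] consistent agree
      where
      D+[a∸D]≡a : D + (a ∸ D) ≡ a
      D+[a∸D]≡a = m+[n∸m]≡n (≮⇒≥ a≮D)
      t< : a ∸ D < m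
      t< = let (r , r∈ , _ , av∈r) = ∈-attrs⁻ {S} a∈ in
           +-cancelˡ-< D (a ∸ D) m (subst (_< D + m) (sym D+[a∸D]≡a) (proj₁ (bounds (member r∈) av∈r)))
      agree : ∀ {b v x} → (b , v) ∈ K (Single (a ∸ D)) → (b , x) ∈ Kξ → x ≡ just v
      agree {x = x} (here refl) bx∈ = ⊥-elim (unanswered a∉ (subst (λ b → (b , x) ∈ Kξ) D+[a∸D]≡a bx∈))

  hESR≡n : hC ESRc S (D + m)
  hESR≡n = hC≡nS ESRc S nS≡ λ Γ h solves depth →
    subst (_≤ h) nS≡ (adversary⇒nS≤depth adversary unanswered⇒¬Cond Γ h solves depth)

Bounds : ℕ → ℕ → ℕ → Set
Bounds n d k =
  (HMax SRc SR-reduced n d k (srValue n d k) × HMax SRc AnySys n d k (srValue n d k))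
  × (HMax ESRc SR-reduced n d k n × HMax ADc AD-reduced n d k n
     × HMax EADc AD-reduced n d k n × HMax ADc AnySys n d k n
     × HMax ARc AnySys n d k n × HMax ESRc AnySys n d k n
     × HMax EADc AnySys n d k n × HMax EARc AnySys n d k n)

Witness : List Rule → ℕ → ℕ → ℕ → Set
Witness S n d k = IsSystem S × SR-reduced S × nS S ≡ n × dS S ≡ d × kS S ≡ k

witness : ∀ {S n d k} → IsSystem S → SR-reduced S → Parameters S n d k → Witness S n d k
witness isSystem reduced parameters = isSystem , reduced , nS≡ , dS≡ , kS≡
  where open Parameters parameters

UpperBound : Cls → ℕ → ℕ → ℕ → ℕ → Set
UpperBound C n d k v = ∀ S → IsSystem S → nS S ≡ n → dS S ≡ d → kS S ≡ k → Σ ℕ λ m → hC C S m × m ≤ v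

upper-n : ∀ C {n d k} → UpperBound C n d k n
upper-n C S _ refl _ _ = hC≤nS C S

HMax-from : ∀ C P {n d k v} → UpperBound C n d k v → (∀ {S} → SR-reduced S → P S) →
  (Σ (List Rule) λ S → Witness S n d k × hC C S v) → HMax C P n d k v
HMax-from C P upper P-reduced (S , (isSystem , reduced , n≡ , d≡ , k≡) , hC-S) =
  (S , isSystem , P-reduced reduced , n≡ , d≡ , k≡ , hC-S) , λ S isSystem _ → upper S isSystem

bounds-from : ∀ {n d k} → UpperBound SRc n d k (srValue n d k) →
  (Σ (List Rule) λ S → Witness S n d k × hC SRc S (srValue n d k)) →
  (Σ (List Rule) λ S → Witness S n d k × hC ESRc S n) →
  (Σ (List Rule) λ S → Witness S n d k × hC ADc S n × hC EADc S n × hC ARc S n × hC EARc S n) →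
  Bounds n d k
bounds-from upper-SR SR-witness ESR-witness (S , w , hAD , hEAD , hAR , hEAR) =
  (HMax-from SRc SR-reduced upper-SR (λ r → r) SR-witness , HMax-from SRc AnySys upper-SR (λ _ → tt) SR-witness) ,
  HMax-from ESRc SR-reduced (upper-n ESRc) (λ r → r) ESR-witness ,
  HMax-from ADc AD-reduced (upper-n ADc) SR-reduced⇒AD-reduced (S , w , hAD) ,
  HMax-from EADc AD-reduced (upper-n EADc) SR-reduced⇒AD-reduced (S , w , hEAD) ,
  HMax-from ADc AnySys (upper-n ADc) (λ _ → tt) (S , w , hAD) ,
  HMax-from ARc AnySys (upper-n ARc) (λ _ → tt) (S , w , hAR) ,
  HMax-from ESRc AnySys (upper-n ESRc) (λ _ → tt) ESR-witness ,
  HMax-from EADc AnySys (upper-n EADc) (λ _ → tt) (S , w , hEAD) ,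
  HMax-from EARc AnySys (upper-n EARc) (λ _ → tt) (S , w , hEAR)

bounds-d≡1 : ∀ n′ kk → Bounds (suc n′) 1 (suc kk)
bounds-d≡1 n′ kk = bounds-from upper-SR
  (S , w , hSR≡d (hSR≤1 (proj₂ attr₀) (≤-reflexive (Parameters.dS≡ parameters))))
  (S , w , hESR≡n-without-core refl)
  (S , w , hC≡n ADc (λ cond → cond) , hC≡n EADc (λ cond → cond) , hC≡n ARc CondAR⇒CondAD , hC≡n EARc CondAR⇒CondAD)
  where
  open Sunflower 0 n′ kk
  w : Witness S (suc n′) 1 (suc kk)
  w = witness isSystem reduced parameters
  some-attr : ∀ S → nS S ≡ suc n′ → Σ ℕ λ a → a ∈ attrs S
  some-attr S n≡ with attrs S
  ... | [] = ⊥-elim (0≢1+n n≡)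
  ... | a ∷ _ = a , here refl
  attr₀ : Σ ℕ λ a → a ∈ attrs S
  attr₀ = some-attr S (Parameters.nS≡ parameters)
  upper-SR : UpperBound SRc (suc n′) 1 (suc kk) 1
  upper-SR S _ n≡ d≡ _ = hSR≤1 (proj₂ (some-attr S n≡)) (≤-reflexive d≡)

bounds-k≡1 : ∀ d′ m → Bounds (suc d′ + suc m) (suc (suc d′)) 1
bounds-k≡1 d′ m = bounds-from upper-SR
  (S , w , hSR≡d (hSR≤d-at (Petal∈ z<s) (≤-reflexive (Parameters.kS≡ parameters)) (Parameters.dS≡ parameters)))
  (B.S , subst (λ n → Witness B.S n (suc (suc d′)) 1 × hC ESRc B.S n) (sym (+-suc (suc d′) m))
    (witness B.isSystem B.reduced B.parameters , B.hESR≡n))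
  (S , w , hC≡n ADc (λ cond → cond) , hC≡n EADc (λ cond → cond) , hC≡n ARc CondAR⇒CondAD , hC≡n EARc CondAR⇒CondAD)
  where
  open Sunflower (suc d′) m 0
  module B = BlockAndSingletons (suc d′) m
  w : Witness S (suc d′ + suc m) (suc (suc d′)) 1
  w = witness isSystem reduced parameters
  hSR≤d-at : ∀ {S r d} → r ∈ S → kS S ≤ 1 → dS S ≡ d → Σ ℕ λ h → hC SRc S h × h ≤ d
  hSR≤d-at r∈ kS≤1 refl = hSR≤dS r∈ kS≤1
  upper-SR : UpperBound SRc (suc d′ + suc m) (suc (suc d′)) 1 (suc (suc d′))
  upper-SR [] (S≢[] , _) _ _ _ = ⊥-elim (S≢[] refl)
  upper-SR (r ∷ S) _ _ d≡ k≡ = hSR≤d-at (here refl) (≤-reflexive k≡) d≡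

bounds-k≥2-d≥2 : ∀ nn kk d′ → suc d′ ≤ nn → Bounds (suc nn) (suc (suc d′)) (suc (suc kk))
bounds-k≥2-d≥2 nn kk d′ d≤n = bounds-from (upper-n SRc) (S , w , hC≡n SRc) (S , w , hC≡n ESRc)
  (S , w , hC≡n ADc , hC≡n EADc , hC≡n ARc , hC≡n EARc)
  where
  open PairSystem nn kk d′ d≤n
  w : Witness S (suc nn) (suc (suc d′)) (suc (suc kk))
  w = witness isSystem reduced parameters

theorem1 : ∀ (n d k : ℕ) → 1 ≤ n → 1 ≤ d → 1 ≤ k → d ≤ n →
    (HMax SRc SR-reduced n d k (srValue n d k) × HMax SRc AnySys n d k (srValue n d k))
    × (HMax ESRc SR-reduced n d k n × HMax ADc AD-reduced n d k n
       × HMax EADc AD-reduced n d k n × HMax ADc AnySys n d k n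
       × HMax ARc AnySys n d k n × HMax ESRc AnySys n d k n
       × HMax EADc AnySys n d k n × HMax EARc AnySys n d k n)
theorem1 (suc n′) (suc zero) (suc kk) _ _ _ _ = bounds-d≡1 n′ kk
theorem1 n (suc (suc d′)) (suc zero) _ _ _ d≤n =
  subst (λ n → Bounds n (suc (suc d′)) 1) (trans (+-suc (suc d′) m) (m+[n∸m]≡n d≤n)) (bounds-k≡1 d′ m)
  where
  m : ℕ
  m = n ∸ suc (suc d′)
theorem1 (suc nn) (suc (suc d′)) (suc (suc kk)) _ _ _ (s≤s d≤n) = bounds-k≥2-d≥2 nn kk d′ d≤n
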